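{- Let $G$ be a chordal graph on $[n]$ and let $1\le i<j\le n$ with $\{i,j\}\in E(G)$ (so $\mathrm{Shift}_{ij}$ is an edge shift of $G$). Then (i) $\mathrm{Shift}_{ij}(G)$ is chordal; (ii) $|T_k(G)|=|T_k(\mathrm{Shift}_{ij}(G))|$ for all $1\le k\le n$; (iii) if $G$ is $k$-connected, then $\mathrm{Shift}_{ij}(G)$ is $k$-connected.
   Context: Graphs have no loops or multiple edges; $G$ is chordal if every cycle of length $>3$ has a chord. For $1\le i<j\le n$, $\mathrm{Shift}_{ij}(G)$ is the graph on $[n]$ whose edges are $C_{ij}(S)$ for $S\in E(G)$, where $C_{ij}(S)=(S\setminus\{j\})\cup\{i\}$ if $j\in S$, $i\notin S$ and $(S\setminus\{j\})\cup\{i\}\notin E(G)$, and $C_{ij}(S)=S$ otherwise. For a graph $H$ on $[n]$, $T_k(H)=\{A\subset[n]:|A|=k,\ E(K_A)\subset E(H)\}$, where $K_A$ is the complete graph on $A$. $k$-connected has its usual graph-theoretic meaning. -}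

module Defs where

open import Data.Bool using (Bool; true; false; _∧_; _∨_; not; if_then_else_)
open import Data.Bool.Properties using () renaming (_≟_ to _≟B_)
open import Data.Nat using (ℕ; zero; suc; _≤_; _<_; _≡ᵇ_)
open import Data.Fin using (Fin; zero; suc; toℕ; fromℕ)
import Data.Fin as Fin
open import Data.Fin.Subset using (Subset; ⁅_⁆; _∪_; _─_; ∣_∣; _∈_; _∉_)
open import Data.Vec using (Vec; []; _∷_; lookup)
open import Data.Vec.Properties using (≡-dec)
open import Data.List using (List; []; _∷_; _++_; map; length; allFin)
open import Data.Nat.ListAction using (sum)
open import Data.Bool.ListAction using (all; any)
open import Data.Product using (Σ; _×_; _,_; ∃)
open import Data.Sum using (_⊎_)
open import Function.Definitions using (Injective)
open import Relation.Nullary using (¬_; ⌊_⌋)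
open import Relation.Binary.PropositionalEquality using (_≡_; _≢_)

-- A graph is given by its edge set E(G), a (decidable) family of subsets
-- of [n], each of which has exactly two elements (no loops; and being a
-- set of 2-subsets there are no multiple edges).

Graph : ℕ → Set
Graph n = Subset n → Bool

IsSimpleGraph : {n : ℕ} → Graph n → Set
IsSimpleGraph G = ∀ S → G S ≡ true → ∣ S ∣ ≡ 2

pair : {n : ℕ} → Fin n → Fin n → Subset n
pair u v = ⁅ u ⁆ ∪ ⁅ v ⁆

_∈E_ : {n : ℕ} → Subset n → Graph n → Set
S ∈E G = G S ≡ true

Adj : {n : ℕ} → Graph n → Fin n → Fin n → Set
Adj G u v = pair u v ∈E G

allSubsets : (n : ℕ) → List (Subset n)
allSubsets zero    = [] ∷ []
allSubsets (suc n) = map (true ∷_) (allSubsets n) ++ map (false ∷_) (allSubsets n)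

_≟S_ : {n : ℕ} → (S T : Subset n) → Bool
S ≟S T = ⌊ ≡-dec _≟B_ S T ⌋

module _ {n : ℕ} (G : Graph n) (i j : Fin n) where

  shifted : Subset n → Subset n
  shifted S = (S ─ ⁅ j ⁆) ∪ ⁅ i ⁆

  C : Subset n → Subset n
  C S = if lookup S j ∧ not (lookup S i) ∧ not (G (shifted S))
        then shifted S else S

  shiftEdge : Subset n → Bool
  shiftEdge T = any (λ S → G S ∧ (C S ≟S T)) (allSubsets n)

Shift : {n : ℕ} → Graph n → Fin n → Fin n → Graph n
Shift G i j = shiftEdge G i j

-- A cycle of length m = suc p ≥ 4 is an injective sequence
-- v : Fin (suc p) → [n] with v a ~ v (a+1) and v p ~ v 0.
-- A chord is an edge of G joining two cycle vertices that are not
-- consecutive on the cycle.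

CycConsec : {p : ℕ} → Fin (suc p) → Fin (suc p) → Set
CycConsec {p} a b =
  (toℕ b ≡ suc (toℕ a)) ⊎ (toℕ a ≡ suc (toℕ b)) ⊎
  ((a ≡ zero) × (b ≡ fromℕ p)) ⊎ ((b ≡ zero) × (a ≡ fromℕ p))

record IsCycle {n : ℕ} (G : Graph n) (p : ℕ) (v : Fin (suc p) → Fin n) : Set where
  field
    distinct : Injective _≡_ _≡_ v
    step     : ∀ a b → toℕ b ≡ suc (toℕ a) → Adj G (v a) (v b)
    close    : Adj G (v (fromℕ p)) (v zero)

HasChord : {n : ℕ} → Graph n → (p : ℕ) → (Fin (suc p) → Fin n) → Set
HasChord G p v =
  Σ (Fin (suc p)) λ a → Σ (Fin (suc p)) λ b →
    (a ≢ b) × ¬ CycConsec a b × Adj G (v a) (v b)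

Chordal : {n : ℕ} → Graph n → Set
Chordal G = ∀ (p : ℕ) (v : Fin (suc p) → Fin _) → 3 ≤ p → IsCycle G p v → HasChord G p v

cliqueB : {n : ℕ} → Graph n → Subset n → Bool
cliqueB {n} H A =
  all (λ u → all (λ v →
        not (lookup A u) ∨ not (lookup A v) ∨ ⌊ u Fin.≟ v ⌋ ∨ H (pair u v))
      (allFin n)) (allFin n)

inTk : {n : ℕ} → ℕ → Graph n → Subset n → Bool
inTk k H A = (∣ A ∣ ≡ᵇ k) ∧ cliqueB H A

card-T : {n : ℕ} → ℕ → Graph n → ℕ
card-T {n} k H = sum (map (λ A → if inTk k H A then 1 else 0) (allSubsets n))

data Path {n : ℕ} (G : Graph n) (X : Subset n) : Fin n → Fin n → Set where
  here : ∀ {u} → u ∉ X → Path G X u u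
  step : ∀ {u w v} → u ∉ X → Adj G u w → Path G X w v → Path G X u v

ConnectedMinus : {n : ℕ} → Graph n → Subset n → Set
ConnectedMinus G X = ∀ u v → u ∉ X → v ∉ X → Path G X u v

KConnected : {n : ℕ} → ℕ → Graph n → Set
KConnected {n} k G = (k < n) × (∀ (X : Subset n) → ∣ X ∣ < k → ConnectedMinus G X)

-- In H = Shift G i j the vertex i becomes adjacent to N(i) ∪ N(j) and j keeps only N(i) ∩ N(j) and i;
-- all other adjacencies are those of G.
--
-- Chordality: rotate a chordless cycle of H of length ≥ 4 so that it starts at j, or else at i. In a
-- chordal graph a vertex adjacent to both ends of an induced path is adjacent to its second vertex, and
-- the cycle z₁ f₁ … fₚ z₂ closed by an edge z₁z₂ has a chord; in each case this yields a chord in H.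
--
-- Cliques: pair each A with the set B obtained by exchanging i and j. If i ∈ A and j ∉ A, then A is an
-- H-clique iff A or B is a G-clique, and B is an H-clique iff both are, so the numbers of cliques among
-- A, B agree in G and H. Summing over all A, and using that the exchange is an involution, gives
-- |T_k(G)| = |T_k(H)|.
--
-- Connectivity: replace every G-edge of a path in G − X by a path in H − X. The only hard case is an edge
-- j x with i ∈ X, j ∉ X: G − (X − i + j) is still connected, and a shortest walk j … x … i in it has, by
-- chordality, a single inner vertex, a common neighbour of i and j through which H reaches x.

module Submission where

open import Defs
open import Data.Bool using (Bool; true; false; _∧_; _∨_; not; if_then_else_)
open import Data.Bool.ListAction using (any; all)
open import Data.Bool.Properties using (∨-zeroʳ; ¬-not; T-≡) renaming (_≟_ to _≟B_)
open import Data.Nat using (ℕ; zero; suc; _+_; _*_; _∸_; _≤_; _<_; z≤n; s≤s; _≤?_; _<?_; _≡ᵇ_)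
open import Data.Nat.Properties using (≤-refl; ≤-trans; ≤-pred; <-irrefl; ≤∧≢⇒<; <⇒≤; suc-injective; <-cmp; m≤n⇒m<n∨m≡n; ≤-reflexive; anyUpTo?; m≤n⇒m≤1+n; n≤1+n; m+n≡0⇒m≡0; m+n≡0⇒n≡0; m<m+n; +-monoˡ-<; +-assoc; +-comm; +-identityʳ; m≤m+n; +-monoˡ-≤; m+[n∸m]≡n; ≤-<-trans; ≰⇒>; *-identityʳ; *-identityˡ; *-distribʳ-+; *-cancelˡ-≡) renaming (_≟_ to _≟N_)
open import Data.Nat.Induction using (<-rec)
open import Data.Nat.ListAction using (sum)
open import Data.Nat.ListAction.Properties using (sum-++)
open import Data.Fin as Fin using (Fin; zero; suc; toℕ; fromℕ)
open import Data.Fin.Properties using (toℕ-injective; toℕ≤pred[n]; toℕ-fromℕ; <⇒≢) renaming (_≟_ to _≟F_)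
open import Data.Fin.Subset using (Subset; ⁅_⁆; _∪_; _─_; ∣_∣; _∉_)
open import Data.Fin.Subset.Properties using (∪-comm; ∪-idem; ∣⁅x⁆∣≡1)
open import Data.Vec using (Vec; []; _∷_; lookup; tabulate; _[_]≔_)
open import Data.Vec.Properties using (≡-dec; tabulate∘lookup; tabulate-cong; lookup-replicate; lookup-zipWith; lookup∘update; lookup∘update′; []=⇒lookup; lookup⇒[]=; ∷-injectiveˡ; ∷-injectiveʳ)
open import Data.List using (List; []; _∷_; map; allFin)
open import Data.List.Properties using (map-++; map-∘)
open import Data.List.Membership.Propositional using (_∈_; lose)
open import Data.List.Membership.Propositional.Properties using (∈-map⁺; ∈-++⁺ˡ; ∈-++⁺ʳ; ∈-allFin)
open import Data.List.Relation.Unary.All as All using ()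
open import Data.List.Relation.Unary.All.Properties using (all⁺; all⁻)
open import Data.List.Relation.Unary.Any using (here; satisfied)
open import Data.List.Relation.Unary.Any.Properties using (any⁺; any⁻)
open import Data.Product using (Σ; _×_; _,_; proj₁; proj₂)
open import Data.Sum using (_⊎_; inj₁; inj₂)
open import Data.Empty using (⊥; ⊥-elim)
open import Function using (_∘_)
open import Function.Bundles using (Equivalence)
open import Relation.Nullary using (¬_; yes; no; Dec; contradiction; ⌊_⌋)
open import Relation.Nullary.Decidable using (_×-dec_; ¬?)
open import Relation.Binary.PropositionalEquality
open import Relation.Binary.Definitions using (tri<; tri≈; tri>)

-- Subsets and the shifted edge set

true≢false : true ≢ false
true≢false ()

⊎-resolveʳ : ∀ {A B : Set} → A ⊎ B → ¬ A → B
⊎-resolveʳ (inj₁ a) ¬a = contradiction a ¬a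
⊎-resolveʳ (inj₂ b) _  = b

⊎-resolveˡ : ∀ {A B : Set} → A ⊎ B → ¬ B → A
⊎-resolveˡ (inj₁ a) _  = a
⊎-resolveˡ (inj₂ b) ¬b = contradiction b ¬b

lookup-extensionality : ∀ {A : Set} {n} {S T : Vec A n} → (∀ x → lookup S x ≡ lookup T x) → S ≡ T
lookup-extensionality {S = S} {T} h = begin
  S                  ≡⟨ sym (tabulate∘lookup S) ⟩
  tabulate (lookup S) ≡⟨ tabulate-cong h ⟩
  tabulate (lookup T) ≡⟨ tabulate∘lookup T ⟩
  T                  ∎
  where open ≡-Reasoning

lookup-⁅x⁆-x : ∀ {n} (x : Fin n) → lookup ⁅ x ⁆ x ≡ true
lookup-⁅x⁆-x zero    = refl
lookup-⁅x⁆-x (suc x) = lookup-⁅x⁆-x x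

lookup-⁅x⁆-y : ∀ {n} {x y : Fin n} → x ≢ y → lookup ⁅ x ⁆ y ≡ false
lookup-⁅x⁆-y {x = zero}  {zero}  x≢y = contradiction refl x≢y
lookup-⁅x⁆-y {x = zero}  {suc y} _   = lookup-replicate y false
lookup-⁅x⁆-y {x = suc x} {zero}  _   = refl
lookup-⁅x⁆-y {x = suc x} {suc y} x≢y = lookup-⁅x⁆-y (x≢y ∘ cong suc)

lookup-∪ : ∀ {n} (S T : Subset n) x → lookup (S ∪ T) x ≡ lookup S x ∨ lookup T x
lookup-∪ S T x = lookup-zipWith _∨_ x S T

lookup-─ : ∀ {n} (S T : Subset n) x → lookup (S ─ T) x ≡ lookup S x ∧ not (lookup T x)
lookup-─ (true  ∷ _) (true  ∷ _) zero    = refl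
lookup-─ (true  ∷ _) (false ∷ _) zero    = refl
lookup-─ (false ∷ _) (true  ∷ _) zero    = refl
lookup-─ (false ∷ _) (false ∷ _) zero    = refl
lookup-─ (a ∷ S) (b ∷ T)     (suc x) = lookup-─ S T x

lookup≡false⇒≢ : ∀ {n} {A : Subset n} {x y} → lookup A y ≡ false → lookup A x ≡ true → x ≢ y
lookup≡false⇒≢ Ay Ax refl = true≢false (trans (sym Ax) Ay)

≟S-sound : ∀ {n} {S T : Subset n} → (S ≟S T) ≡ true → S ≡ T
≟S-sound {S = S} {T} h with ≡-dec _≟B_ S T
... | yes S≡T = S≡T
... | no  _   = contradiction (sym h) true≢false

≟S-refl : ∀ {n} (S : Subset n) → (S ≟S S) ≡ true
≟S-refl S with ≡-dec _≟B_ S S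
... | yes _   = refl
... | no  S≢S = contradiction refl S≢S

≟S-false⇒≢ : ∀ {n} {S T : Subset n} → (S ≟S T) ≡ false → S ≢ T
≟S-false⇒≢ {S = S} S≠T refl = true≢false (trans (sym (≟S-refl S)) S≠T)

∈-allSubsets : ∀ {n} (S : Subset n) → S ∈ allSubsets n
∈-allSubsets []          = here refl
∈-allSubsets (true  ∷ S) = ∈-++⁺ˡ (∈-map⁺ (true ∷_) (∈-allSubsets S))
∈-allSubsets (false ∷ S) = ∈-++⁺ʳ (map (true ∷_) (allSubsets _)) (∈-map⁺ (false ∷_) (∈-allSubsets S))

any-allSubsets⁺ : ∀ {n} (p : Subset n → Bool) S → p S ≡ true → any p (allSubsets n) ≡ true
any-allSubsets⁺ p S pS = Equivalence.to T-≡ (any⁺ p (lose (∈-allSubsets S) (Equivalence.from T-≡ pS)))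

any⇒witness : ∀ {A : Set} (p : A → Bool) xs → any p xs ≡ true → Σ A λ x → p x ≡ true
any⇒witness p xs h with satisfied (any⁻ p xs (Equivalence.from T-≡ h))
... | x , px = x , Equivalence.to T-≡ px

lookup-pair-left : ∀ {n} (u v : Fin n) → lookup (pair u v) u ≡ true
lookup-pair-left u v rewrite lookup-∪ ⁅ u ⁆ ⁅ v ⁆ u | lookup-⁅x⁆-x u = refl

lookup-pair-right : ∀ {n} (u v : Fin n) → lookup (pair u v) v ≡ true
lookup-pair-right u v rewrite lookup-∪ ⁅ u ⁆ ⁅ v ⁆ v | lookup-⁅x⁆-x v = ∨-zeroʳ _

lookup-pair-other : ∀ {n} {u v x : Fin n} → u ≢ x → v ≢ x → lookup (pair u v) x ≡ false
lookup-pair-other {u = u} {v} {x} u≢x v≢x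
  rewrite lookup-∪ ⁅ u ⁆ ⁅ v ⁆ x | lookup-⁅x⁆-y u≢x | lookup-⁅x⁆-y v≢x = refl

Adj-sym : ∀ {n} (G : Graph n) {u v} → Adj G u v → Adj G v u
Adj-sym G {u} {v} = subst (_∈E G) (∪-comm ⁅ u ⁆ ⁅ v ⁆)

Adj-irrefl : ∀ {n} {G : Graph n} → IsSimpleGraph G → ∀ {u} → ¬ Adj G u u
Adj-irrefl simple {u} uu with trans (sym (∣⁅x⁆∣≡1 u)) (trans (cong ∣_∣ (sym (∪-idem ⁅ u ⁆))) (simple (pair u u) uu))
... | ()

∣[]≔true∣ : ∀ {n} (S : Subset n) k → lookup S k ≡ false → ∣ S [ k ]≔ true ∣ ≡ suc ∣ S ∣
∣[]≔true∣ (false ∷ S) zero    _  = refl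
∣[]≔true∣ (true  ∷ S) (suc k) Sk = cong suc (∣[]≔true∣ S k Sk)
∣[]≔true∣ (false ∷ S) (suc k) Sk = ∣[]≔true∣ S k Sk

∣[]≔false∣ : ∀ {n} (S : Subset n) k → lookup S k ≡ true → suc ∣ S [ k ]≔ false ∣ ≡ ∣ S ∣
∣[]≔false∣ (true  ∷ S) zero    _  = refl
∣[]≔false∣ (true  ∷ S) (suc k) Sk = cong suc (∣[]≔false∣ S k Sk)
∣[]≔false∣ (false ∷ S) (suc k) Sk = ∣[]≔false∣ S k Sk

module Swap {n : ℕ} {i j : Fin n} (i≢j : i ≢ j) where

  swap : Subset n → Subset n
  swap A = A [ i ]≔ lookup A j [ j ]≔ lookup A i

  lookup-swap-i : ∀ A → lookup (swap A) i ≡ lookup A j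
  lookup-swap-i A = trans (lookup∘update′ i≢j (A [ i ]≔ lookup A j) (lookup A i)) (lookup∘update i A (lookup A j))

  lookup-swap-j : ∀ A → lookup (swap A) j ≡ lookup A i
  lookup-swap-j A = lookup∘update j (A [ i ]≔ lookup A j) (lookup A i)

  lookup-swap-other : ∀ A {x} → x ≢ i → x ≢ j → lookup (swap A) x ≡ lookup A x
  lookup-swap-other A x≢i x≢j = trans (lookup∘update′ x≢j (A [ i ]≔ lookup A j) (lookup A i)) (lookup∘update′ x≢i A (lookup A j))

  swap-involutive : ∀ A → swap (swap A) ≡ A
  swap-involutive A = lookup-extensionality pointwise
    where
    pointwise : ∀ y → lookup (swap (swap A)) y ≡ lookup A y
    pointwise y with y ≟F i | y ≟F j
    ... | yes refl | _        = trans (lookup-swap-i (swap A)) (lookup-swap-j A)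
    ... | no  _    | yes refl = trans (lookup-swap-j (swap A)) (lookup-swap-i A)
    ... | no  y≢i  | no  y≢j  = trans (lookup-swap-other (swap A) y≢i y≢j) (lookup-swap-other A y≢i y≢j)

  swap-fixed : ∀ A → lookup A i ≡ lookup A j → swap A ≡ A
  swap-fixed A Ai≡Aj = lookup-extensionality pointwise
    where
    pointwise : ∀ y → lookup (swap A) y ≡ lookup A y
    pointwise y with y ≟F i | y ≟F j
    ... | yes refl | _        = trans (lookup-swap-i A) (sym Ai≡Aj)
    ... | no  _    | yes refl = trans (lookup-swap-j A) Ai≡Aj
    ... | no  y≢i  | no  y≢j  = lookup-swap-other A y≢i y≢j

  ∣swap∣ : ∀ A → ∣ swap A ∣ ≡ ∣ A ∣
  ∣swap∣ A with lookup A i ≟B lookup A j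
  ... | yes Ai≡Aj = cong ∣_∣ (swap-fixed A Ai≡Aj)
  ... | no  Ai≢Aj = exchange (lookup A i) (lookup A j) refl refl Ai≢Aj
    where
    exchange : ∀ a b → lookup A i ≡ a → lookup A j ≡ b → a ≢ b → ∣ A [ i ]≔ b [ j ]≔ a ∣ ≡ ∣ A ∣
    exchange true  true  _  _  a≢b = contradiction refl a≢b
    exchange false false _  _  a≢b = contradiction refl a≢b
    exchange true  false Ai Aj _   =
      trans (∣[]≔true∣ (A [ i ]≔ false) j (trans (lookup∘update′ (i≢j ∘ sym) A false) Aj)) (∣[]≔false∣ A i Ai)
    exchange false true  Ai Aj _   =
      suc-injective (trans (∣[]≔false∣ (A [ i ]≔ true) j (trans (lookup∘update′ (i≢j ∘ sym) A true) Aj)) (∣[]≔true∣ A i Ai))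

Shift⁺ : ∀ {n} (G : Graph n) i j {S} → S ∈E G → C G i j S ∈E Shift G i j
Shift⁺ G i j {S} S∈G = any-allSubsets⁺ (λ S′ → G S′ ∧ (C G i j S′ ≟S C G i j S)) S witness
  where
  witness : G S ∧ (C G i j S ≟S C G i j S) ≡ true
  witness rewrite S∈G = ≟S-refl (C G i j S)

Shift⁻ : ∀ {n} (G : Graph n) i j {T} → T ∈E Shift G i j → Σ (Subset n) λ S → S ∈E G × C G i j S ≡ T
Shift⁻ {n} G i j {T} T∈H with any⇒witness (λ S → G S ∧ (C G i j S ≟S T)) (allSubsets n) T∈H
... | S , h with G S in S∈G
... | true = S , S∈G , ≟S-sound h

module ShiftAdjacency {n : ℕ} (G : Graph n) {i j : Fin n} (i≢j : i ≢ j) where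

  private
    H : Graph n
    H = Shift G i j

    sh : Subset n → Subset n
    sh = shifted G i j

  moves : Subset n → Bool
  moves S = lookup S j ∧ not (lookup S i) ∧ not (G (sh S))

  moves⁻ : ∀ {S} → moves S ≡ true → lookup S j ≡ true × lookup S i ≡ false × G (sh S) ≡ false
  moves⁻ {S} h with lookup S j | lookup S i | G (sh S)
  moves⁻ refl | true | false | false = refl , refl , refl

  moves⁺ : ∀ S → lookup S j ≡ true → lookup S i ≡ false → G (sh S) ≡ false → moves S ≡ true
  moves⁺ S Sj Si GshS rewrite Sj | Si | GshS = refl

  stays-without-j : ∀ S → lookup S j ≡ false → moves S ≡ false
  stays-without-j S Sj rewrite Sj = refl

  stays-with-i : ∀ S → lookup S i ≡ true → moves S ≡ false
  stays-with-i S Si rewrite Si with lookup S j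
  ... | true  = refl
  ... | false = refl

  stays-if-target-edge : ∀ S → G (sh S) ≡ true → moves S ≡ false
  stays-if-target-edge S GshS rewrite GshS with lookup S j | lookup S i
  ... | true  | true  = refl
  ... | true  | false = refl
  ... | false | _     = refl

  target-edge-if-stays : ∀ S → lookup S j ≡ true → lookup S i ≡ false → moves S ≡ false → G (sh S) ≡ true
  target-edge-if-stays S Sj Si stays rewrite Sj | Si with G (sh S) | stays
  ... | true | _ = refl

  image-if-stays : ∀ {S} → S ∈E G → moves S ≡ false → S ∈E H
  image-if-stays {S} S∈G stays = subst (_∈E H) C≡S (Shift⁺ G i j S∈G)
    where
    C≡S : C G i j S ≡ S
    C≡S rewrite stays = refl

  image-if-moves : ∀ {S} → S ∈E G → moves S ≡ true → sh S ∈E H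
  image-if-moves {S} S∈G move = subst (_∈E H) C≡shS (Shift⁺ G i j S∈G)
    where
    C≡shS : C G i j S ≡ sh S
    C≡shS rewrite move = refl

  preimage : ∀ {T} → T ∈E H → (T ∈E G × moves T ≡ false) ⊎ (Σ (Subset n) λ S → S ∈E G × moves S ≡ true × sh S ≡ T)
  preimage {T} T∈H with Shift⁻ G i j T∈H
  ... | S , S∈G , CS≡T with moves S in move
  ... | true  = inj₂ (S , S∈G , move , CS≡T)
  ... | false rewrite sym CS≡T = inj₁ (S∈G , move)

  lookup-sh : ∀ S x → lookup (sh S) x ≡ (lookup S x ∧ not (lookup ⁅ j ⁆ x)) ∨ lookup ⁅ i ⁆ x
  lookup-sh S x rewrite lookup-∪ (S ─ ⁅ j ⁆) ⁅ i ⁆ x | lookup-─ S ⁅ j ⁆ x = refl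

  lookup-sh-i : ∀ S → lookup (sh S) i ≡ true
  lookup-sh-i S rewrite lookup-sh S i | lookup-⁅x⁆-x i = ∨-zeroʳ _

  lookup-sh-j : ∀ S → lookup (sh S) j ≡ false
  lookup-sh-j S rewrite lookup-sh S j | lookup-⁅x⁆-x j | lookup-⁅x⁆-y i≢j with lookup S j
  ... | true  = refl
  ... | false = refl

  lookup-sh-other : ∀ S {x} → i ≢ x → j ≢ x → lookup (sh S) x ≡ lookup S x
  lookup-sh-other S {x} i≢x j≢x rewrite lookup-sh S x | lookup-⁅x⁆-y i≢x | lookup-⁅x⁆-y j≢x with lookup S x
  ... | true  = refl
  ... | false = refl

  sh-pair : ∀ {x} → j ≢ x → sh (pair j x) ≡ pair i x
  sh-pair {x} j≢x = lookup-extensionality pointwise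
    where
    pointwise : ∀ y → lookup (sh (pair j x)) y ≡ lookup (pair i x) y
    pointwise y with i ≟F y | j ≟F y
    ... | yes refl | _        = trans (lookup-sh-i (pair j x)) (sym (lookup-pair-left i x))
    ... | no  _    | yes refl = trans (lookup-sh-j (pair j x)) (sym (lookup-pair-other i≢j (j≢x ∘ sym)))
    ... | no  i≢y  | no  j≢y  with x ≟F y
    ...   | yes refl = trans (lookup-sh-other (pair j x) i≢y j≢y) (trans (lookup-pair-right j x) (sym (lookup-pair-right i x)))
    ...   | no  x≢y  = trans (lookup-sh-other (pair j x) i≢y j≢y) (trans (lookup-pair-other j≢y x≢y) (sym (lookup-pair-other i≢y x≢y)))

  unshift-pair : ∀ {S x} → i ≢ x → j ≢ x → moves S ≡ true → sh S ≡ pair i x → S ≡ pair j x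
  unshift-pair {S} {x} i≢x j≢x move shS≡ix = lookup-extensionality pointwise
    where
    pointwise : ∀ y → lookup S y ≡ lookup (pair j x) y
    pointwise y with moves⁻ {S} move | i ≟F y | j ≟F y
    ... | _ , Si , _ | yes refl | _        = trans Si (sym (lookup-pair-other (i≢j ∘ sym) (i≢x ∘ sym)))
    ... | Sj , _     | no  _    | yes refl = trans Sj (sym (lookup-pair-left j x))
    ... | _          | no  i≢y  | no  j≢y  = begin
      lookup S y              ≡⟨ sym (lookup-sh-other S i≢y j≢y) ⟩
      lookup (sh S) y         ≡⟨ cong (λ T → lookup T y) shS≡ix ⟩
      lookup (pair i x) y     ≡⟨ lookup-∪ ⁅ i ⁆ ⁅ x ⁆ y ⟩
      lookup ⁅ i ⁆ y ∨ lookup ⁅ x ⁆ y ≡⟨ cong (_∨ lookup ⁅ x ⁆ y) (trans (lookup-⁅x⁆-y i≢y) (sym (lookup-⁅x⁆-y j≢y))) ⟩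
      lookup ⁅ j ⁆ y ∨ lookup ⁅ x ⁆ y ≡⟨ sym (lookup-∪ ⁅ j ⁆ ⁅ x ⁆ y) ⟩
      lookup (pair j x) y     ∎
      where open ≡-Reasoning

  adj⁺-avoiding-j : ∀ {u v} → u ≢ j → v ≢ j → Adj G u v → Adj H u v
  adj⁺-avoiding-j {u} {v} u≢j v≢j uv = image-if-stays uv (stays-without-j (pair u v) (lookup-pair-other u≢j v≢j))

  adj⁻-avoiding-ij : ∀ {u v} → u ≢ i → u ≢ j → v ≢ i → v ≢ j → Adj H u v → Adj G u v
  adj⁻-avoiding-ij {u} {v} u≢i _ v≢i _ uv with preimage uv
  ... | inj₁ (uv∈G , _)       = uv∈G
  ... | inj₂ (S , _ , _ , shS≡uv) =
    contradiction (trans (sym (lookup-sh-i S)) (cong (λ T → lookup T i) shS≡uv)) (λ eq → true≢false (trans eq (lookup-pair-other u≢i v≢i)))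

  adj⁺-ij : Adj G i j → Adj H i j
  adj⁺-ij ij = image-if-stays ij (stays-with-i (pair i j) (lookup-pair-left i j))

  adj⁺-i : ∀ {x} → x ≢ i → x ≢ j → Adj G j x → Adj H i x
  adj⁺-i {x} x≢i x≢j jx with G (pair i x) in ix
  ... | true  = adj⁺-avoiding-j (i≢j) x≢j ix
  ... | false = subst (_∈E H) (sh-pair (x≢j ∘ sym)) (image-if-moves jx move)
    where
    move : moves (pair j x) ≡ true
    move = moves⁺ (pair j x) (lookup-pair-left j x) (lookup-pair-other (i≢j ∘ sym) x≢i) (trans (cong G (sh-pair (x≢j ∘ sym))) ix)

  adj⁻-i : ∀ {x} → x ≢ i → x ≢ j → Adj H i x → Adj G i x ⊎ Adj G j x
  adj⁻-i x≢i x≢j ix with preimage ix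
  ... | inj₁ (ix∈G , _)           = inj₁ ix∈G
  ... | inj₂ (S , S∈G , move , shS≡ix) = inj₂ (subst (_∈E G) (unshift-pair (x≢i ∘ sym) (x≢j ∘ sym) move shS≡ix) S∈G)

  adj⁺-j : ∀ {x} → x ≢ i → x ≢ j → Adj G j x → Adj G i x → Adj H j x
  adj⁺-j {x} x≢i x≢j jx ix = image-if-stays jx (stays-if-target-edge (pair j x) (trans (cong G (sh-pair (x≢j ∘ sym))) ix))

  adj⁻-j : ∀ {x} → x ≢ i → x ≢ j → Adj H j x → Adj G j x × Adj G i x
  adj⁻-j {x} x≢i x≢j jx with preimage jx
  ... | inj₁ (jx∈G , stays) = jx∈G , subst (_∈E G) (sh-pair (x≢j ∘ sym))
          (target-edge-if-stays (pair j x) (lookup-pair-left j x) (lookup-pair-other (i≢j ∘ sym) x≢i) stays)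
  ... | inj₂ (S , _ , _ , shS≡jx) =
    contradiction (trans (sym (lookup-sh-j S)) (trans (cong (λ T → lookup T j) shS≡jx) (lookup-pair-left j x))) (true≢false ∘ sym)

-- Cycles, chords and chordal relations

search≤ : {P : ℕ → Set} → (∀ k → Dec (P k)) → ∀ m → (Σ ℕ λ k → k ≤ m × P k) ⊎ (∀ k → k ≤ m → ¬ P k)
search≤ P? m with anyUpTo? P? (suc m)
... | yes (k , s≤s k≤m , Pk) = inj₁ (k , k≤m , Pk)
... | no  none               = inj₂ λ k k≤m Pk → none (k , s≤s k≤m , Pk)

OffPath : {V : Set} → ℕ → (ℕ → V) → V → Set
OffPath q f z = ∀ a → 1 ≤ a → a ≤ q → z ≢ f a

module _ {V : Set} (p : ℕ) (f : ℕ → V) (z₁ z₂ : V) where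
  private
    pick : ∀ k → Dec (k ≤ p) → V
    pick k (yes _) = f k
    pick k (no  _) = z₂

  bridged : ℕ → V
  bridged zero    = z₁
  bridged (suc k) = pick (suc k) (suc k ≤? p)

  data BridgedPosition (k : ℕ) (v : V) : Set where
    at-start : k ≡ 0 → v ≡ z₁ → BridgedPosition k v
    in-path  : 1 ≤ k → k ≤ p → v ≡ f k → BridgedPosition k v
    at-end   : k ≡ suc p → v ≡ z₂ → BridgedPosition k v

  bridged-position : ∀ k → k ≤ suc p → BridgedPosition k (bridged k)
  bridged-position zero    _      = at-start refl refl
  bridged-position (suc k) 1+k≤ with suc k ≤? p
  ... | yes 1+k≤p = in-path (s≤s z≤n) 1+k≤p refl
  ... | no  1+k≰p with m≤n⇒m<n∨m≡n 1+k≤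
  ...   | inj₁ 1+k<1+p = contradiction (≤-pred 1+k<1+p) 1+k≰p
  ...   | inj₂ refl    = at-end refl refl

  bridged-middle : ∀ k → 1 ≤ k → k ≤ p → bridged k ≡ f k
  bridged-middle k 1≤k k≤p with bridged-position k (m≤n⇒m≤1+n k≤p)
  ... | at-start refl _ = contradiction 1≤k λ ()
  ... | in-path _ _ eq  = eq
  ... | at-end refl _   = contradiction k≤p (<-irrefl refl)

  bridged-last : bridged (suc p) ≡ z₂
  bridged-last with bridged-position (suc p) ≤-refl
  ... | in-path _ 1+p≤p _ = contradiction 1+p≤p (<-irrefl refl)
  ... | at-end _ eq       = eq

module Cycles {V : Set} (R : V → V → Set) where

  record Cycle (p : ℕ) (f : ℕ → V) : Set where
    field
      injective : ∀ a b → a ≤ p → b ≤ p → f a ≡ f b → a ≡ b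
      edge      : ∀ a → a < p → R (f a) (f (suc a))
      close     : R (f p) (f 0)

  Chord : (p : ℕ) (f : ℕ → V) → Set
  Chord p f = Σ ℕ λ a → Σ ℕ λ b → a < b × b ≤ p × b ≢ suc a × ¬ (a ≡ 0 × b ≡ p) × R (f a) (f b)

  Chordless : (p : ℕ) (f : ℕ → V) → Set
  Chordless p f = ∀ a b → a < b → b ≤ p → b ≢ suc a → ¬ (a ≡ 0 × b ≡ p) → ¬ R (f a) (f b)

  Chord⇒¬Chordless : ∀ {p f} → Chord p f → ¬ Chordless p f
  Chord⇒¬Chordless (a , b , a<b , b≤p , b≢1+a , ¬ends , Rab) chordless = chordless a b a<b b≤p b≢1+a ¬ends Rab

  ChordalRel : Set
  ChordalRel = ∀ p f → 3 ≤ p → Cycle p f → Chord p f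

  chord? : (∀ u v → Dec (R u v)) → ∀ p f → Chord p f ⊎ Chordless p f
  chord? R? p f = fromSearch (search≤ chordFrom? p)
    where
    ChordFrom : ℕ → ℕ → Set
    ChordFrom a b = a < b × b ≢ suc a × ¬ (a ≡ 0 × b ≡ p) × R (f a) (f b)
    chordFrom? : ∀ a → Dec (Σ ℕ λ b → b ≤ p × ChordFrom a b)
    chordFrom? a with search≤ (λ b → a <? b ×-dec ¬? (b ≟N suc a) ×-dec ¬? (a ≟N 0 ×-dec b ≟N p) ×-dec R? (f a) (f b)) p
    ... | inj₁ found = yes found
    ... | inj₂ none  = no λ (b , b≤p , chord) → none b b≤p chord
    fromSearch : (Σ ℕ λ a → a ≤ p × Σ ℕ λ b → b ≤ p × ChordFrom a b)
                 ⊎ (∀ a → a ≤ p → ¬ (Σ ℕ λ b → b ≤ p × ChordFrom a b)) → Chord p f ⊎ Chordless p f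
    fromSearch (inj₁ (a , _ , b , b≤p , a<b , chord)) = inj₁ (a , b , a<b , b≤p , chord)
    fromSearch (inj₂ none) = inj₂ λ a b a<b b≤p b≢1+a ¬ends Rab →
      none a (≤-trans (<⇒≤ a<b) b≤p) (b , b≤p , a<b , b≢1+a , ¬ends , Rab)

  next : ℕ → ℕ → ℕ
  next p x with x ≟N p
  ... | yes _ = 0
  ... | no _ = suc x

  next-last : ∀ p → next p p ≡ 0
  next-last p with p ≟N p
  ... | yes _ = refl
  ... | no ne = ⊥-elim (ne refl)

  next-< : ∀ p x → x < p → next p x ≡ suc x
  next-< p x l with x ≟N p
  ... | yes refl = ⊥-elim (<-irrefl refl l)
  ... | no _ = refl

  next-cases : ∀ p x → x ≤ p → ((x ≡ p) × (next p x ≡ 0)) ⊎ ((x < p) × (next p x ≡ suc x))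
  next-cases p x x≤ with m≤n⇒m<n∨m≡n x≤
  ... | inj₁ l = inj₂ (l , next-< p x l)
  ... | inj₂ refl = inj₁ (refl , next-last p)

  next-≤ : ∀ p x → x ≤ p → next p x ≤ p
  next-≤ p x x≤ with next-cases p x x≤
  ... | inj₁ (_ , e) rewrite e = z≤n
  ... | inj₂ (l , e) rewrite e = l

  next-injective : ∀ p x y → x ≤ p → y ≤ p → next p x ≡ next p y → x ≡ y
  next-injective p x y x≤ y≤ e with next-cases p x x≤ | next-cases p y y≤
  ... | inj₁ (a , _) | inj₁ (b , _) = trans a (sym b)
  ... | inj₁ (_ , e1) | inj₂ (_ , e2) with trans (sym e1) (trans e e2)
  ... | ()
  next-injective p x y x≤ y≤ e | inj₂ (_ , e1) | inj₁ (_ , e2) with trans (sym e1) (trans e e2)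
  ... | ()
  next-injective p x y x≤ y≤ e | inj₂ (_ , e1) | inj₂ (_ , e2) = suc-injective (trans (sym e1) (trans e e2))

  record SuccCycle (p : ℕ) (f : ℕ → V) : Set where
    field
      injective  : ∀ a b → a ≤ p → b ≤ p → f a ≡ f b → a ≡ b
      edge      : ∀ a → a ≤ p → R (f a) (f (next p a))

  SuccChord : (p : ℕ) (f : ℕ → V) → Set
  SuccChord p f = Σ ℕ λ a → Σ ℕ λ b → a ≤ p × b ≤ p × ¬ (a ≡ b) × ¬ (b ≡ next p a) × ¬ (a ≡ next p b) × R (f a) (f b)

  Cycle⇒SuccCycle : ∀ {p f} → Cycle p f → SuccCycle p f
  Cycle⇒SuccCycle {p} {f} c = record { injective = Cycle.injective c ; edge = st }
    where
    st : ∀ a → a ≤ p → R (f a) (f (next p a))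
    st a a≤ with next-cases p a a≤
    ... | inj₁ (refl , e) rewrite e = Cycle.close c
    ... | inj₂ (l , e) rewrite e = Cycle.edge c a l

  SuccCycle⇒Cycle : ∀ {p f} → SuccCycle p f → Cycle p f
  SuccCycle⇒Cycle {p} {f} c = record { injective = SuccCycle.injective c ; edge = st ; close = cl }
    where
    st : ∀ a → a < p → R (f a) (f (suc a))
    st a l = subst (λ x → R (f a) (f x)) (next-< p a l) (SuccCycle.edge c a (<⇒≤ l))
    cl : R (f p) (f 0)
    cl = subst (λ x → R (f p) (f x)) (next-last p) (SuccCycle.edge c p ≤-refl)

  Chord⇒SuccChord : ∀ {p f} → Chord p f → SuccChord p f
  Chord⇒SuccChord {p} {f} (a , b , a<b , b≤p , b≢1+a , ¬ends , Rab) =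
    a , b , <⇒≤ a<p , b≤p , (λ { refl → <-irrefl refl a<b }) , b≢next-a , a≢next-b , Rab
    where
    a<p : a < p
    a<p = ≤-trans a<b b≤p
    b≢next-a : b ≢ next p a
    b≢next-a b≡ = b≢1+a (trans b≡ (next-< p a a<p))
    a≢next-b : a ≢ next p b
    a≢next-b a≡ with next-cases p b b≤p
    ... | inj₁ (b≡p , next≡0)   = ¬ends (trans a≡ next≡0 , b≡p)
    ... | inj₂ (_ , next≡1+b) = <-irrefl refl (≤-trans (s≤s (≤-reflexive (trans (sym next≡1+b) (sym a≡)))) (<⇒≤ (s≤s a<b)))

  SuccChord⇒Chord : (∀ {u v} → R u v → R v u) → ∀ {p f} → SuccChord p f → Chord p f
  SuccChord⇒Chord R-sym {p} {f} (a , b , a≤p , b≤p , a≢b , b≢next-a , a≢next-b , Rab) with <-cmp a b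
  ... | tri≈ _ a≡b _ = contradiction a≡b a≢b
  ... | tri< a<b _ _ = a , b , a<b , b≤p , (λ b≡ → b≢next-a (trans b≡ (sym (next-< p a (≤-trans a<b b≤p))))) ,
                       (λ (a≡0 , b≡p) → a≢next-b (trans a≡0 (sym (trans (cong (next p) b≡p) (next-last p))))) , Rab
  ... | tri> _ _ b<a = b , a , b<a , a≤p , (λ a≡ → a≢next-b (trans a≡ (sym (next-< p b (≤-trans b<a a≤p))))) ,
                       (λ (b≡0 , a≡p) → b≢next-a (trans b≡0 (sym (trans (cong (next p) a≡p) (next-last p))))) , R-sym Rab

  rotate : ℕ → ℕ → ℕ → ℕ
  rotate p zero k = k
  rotate p (suc t) k = next p (rotate p t k)

  rotate-≤ : ∀ p t k → k ≤ p → rotate p t k ≤ p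
  rotate-≤ p zero k k≤ = k≤
  rotate-≤ p (suc t) k k≤ = next-≤ p _ (rotate-≤ p t k k≤)

  rotate-injective : ∀ p t x y → x ≤ p → y ≤ p → rotate p t x ≡ rotate p t y → x ≡ y
  rotate-injective p zero x y _ _ e = e
  rotate-injective p (suc t) x y x≤ y≤ e = rotate-injective p t x y x≤ y≤ (next-injective p _ _ (rotate-≤ p t x x≤) (rotate-≤ p t y y≤) e)

  rotate-next : ∀ p t k → rotate p t (next p k) ≡ next p (rotate p t k)
  rotate-next p zero k = refl
  rotate-next p (suc t) k = cong (next p) (rotate-next p t k)

  rotate-zero : ∀ p t → t ≤ p → rotate p t 0 ≡ t
  rotate-zero p zero _ = refl
  rotate-zero p (suc t) t≤ = trans (cong (next p) (rotate-zero p t (<⇒≤ t≤))) (next-< p t t≤)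

  rotate-SuccCycle : ∀ {p f} t → SuccCycle p f → SuccCycle p (λ k → f (rotate p t k))
  rotate-SuccCycle {p} {f} t c = record
    { injective = λ a b a≤ b≤ e → rotate-injective p t a b a≤ b≤
                                    (SuccCycle.injective c _ _ (rotate-≤ p t a a≤) (rotate-≤ p t b b≤) e)
    ; edge      = λ a a≤ → subst (λ x → R (f (rotate p t a)) (f x)) (sym (rotate-next p t a))
                                 (SuccCycle.edge c _ (rotate-≤ p t a a≤)) }

  rotate-SuccChord : ∀ {p f} t → SuccChord p (λ k → f (rotate p t k)) → SuccChord p f
  rotate-SuccChord {p} {f} t (a , b , a≤ , b≤ , n0 , n1 , n2 , r) =
    rotate p t a , rotate p t b , rotate-≤ p t a a≤ , rotate-≤ p t b b≤ ,
    (λ e → n0 (rotate-injective p t a b a≤ b≤ e)) ,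
    (λ e → n1 (rotate-injective p t b (next p a) b≤ (next-≤ p a a≤) (trans e (sym (rotate-next p t a))))) ,
    (λ e → n2 (rotate-injective p t a (next p b) a≤ (next-≤ p b b≤) (trans e (sym (rotate-next p t b))))) , r

  rotate-Cycle : ∀ {p f} t → Cycle p f → Cycle p (f ∘ rotate p t)
  rotate-Cycle t = SuccCycle⇒Cycle ∘ rotate-SuccCycle t ∘ Cycle⇒SuccCycle

  rotate-Chordless : (∀ {u v} → R u v → R v u) → ∀ {p f} t → Chordless p f → Chordless p (f ∘ rotate p t)
  rotate-Chordless R-sym t chordless a b a<b b≤p b≢1+a ¬ends Rab
    with SuccChord⇒Chord R-sym (rotate-SuccChord t (Chord⇒SuccChord (a , b , a<b , b≤p , b≢1+a , ¬ends , Rab)))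
  ... | a′ , b′ , a′<b′ , b′≤p , b′≢1+a′ , ¬ends′ , Rab′ = chordless a′ b′ a′<b′ b′≤p b′≢1+a′ ¬ends′ Rab′

  record InducedPath (q : ℕ) (f : ℕ → V) : Set where
    field
      injective : ∀ a b → 1 ≤ a → a ≤ q → 1 ≤ b → b ≤ q → f a ≡ f b → a ≡ b
      edge      : ∀ a → 1 ≤ a → a < q → R (f a) (f (suc a))
      induced   : ∀ a b → 1 ≤ a → a < b → b ≤ q → b ≢ suc a → ¬ R (f a) (f b)

  InducedPath-prefix : ∀ {q f} m → m ≤ q → InducedPath q f → InducedPath m f
  InducedPath-prefix m m≤q P = record
    { injective = λ a b 1≤a a≤m 1≤b b≤m → InducedPath.injective P a b 1≤a (≤-trans a≤m m≤q) 1≤b (≤-trans b≤m m≤q)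
    ; edge      = λ a 1≤a a<m → InducedPath.edge P a 1≤a (≤-trans a<m m≤q)
    ; induced   = λ a b 1≤a a<b b≤m → InducedPath.induced P a b 1≤a a<b (≤-trans b≤m m≤q) }

  start-off-path : ∀ {p f} → Cycle p f → OffPath p f (f 0)
  start-off-path c a 1≤a a≤p eq = <-irrefl (sym (Cycle.injective c a 0 a≤p z≤n (sym eq))) 1≤a

  module ChordalRelProperties (R-sym : ∀ {u v} → R u v → R v u) (chordal : ChordalRel) where

    apex-inner-neighbour : ∀ {q f z} → 3 ≤ q → InducedPath q f → OffPath q f z →
                           R z (f 1) → R z (f q) → Σ ℕ λ k → 2 ≤ k × k < q × R z (f k)
    apex-inner-neighbour {suc q} {f} {z} (s≤s 2≤q) P off z1 zq = fromChord (chordal (suc q) g (s≤s 2≤q) cycle)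
      where
      g : ℕ → V
      g zero    = z
      g (suc k) = f (suc k)
      g-injective : ∀ a b → a ≤ suc q → b ≤ suc q → g a ≡ g b → a ≡ b
      g-injective zero    zero    _   _   _  = refl
      g-injective zero    (suc b) _   b≤  eq = contradiction eq (off (suc b) (s≤s z≤n) b≤)
      g-injective (suc a) zero    a≤  _   eq = contradiction (sym eq) (off (suc a) (s≤s z≤n) a≤)
      g-injective (suc a) (suc b) a≤  b≤  eq = InducedPath.injective P (suc a) (suc b) (s≤s z≤n) a≤ (s≤s z≤n) b≤ eq
      g-edge : ∀ a → a < suc q → R (g a) (g (suc a))
      g-edge zero    _   = z1
      g-edge (suc a) a<q = InducedPath.edge P (suc a) (s≤s z≤n) a<q
      cycle : Cycle (suc q) g
      cycle = record { injective = g-injective ; edge = g-edge ; close = R-sym zq }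
      fromChord : Chord (suc q) g → Σ ℕ λ k → 2 ≤ k × k < suc q × R z (f k)
      fromChord (zero , suc b , _ , b≤ , b≢1 , ¬ends , zb) =
        suc b , ≤∧≢⇒< (s≤s z≤n) (b≢1 ∘ sym) , ≤∧≢⇒< b≤ (λ b≡q → ¬ends (refl , b≡q)) , zb
      fromChord (suc a , suc b , a<b , b≤ , b≢1+a , _ , ab) =
        contradiction ab (InducedPath.induced P (suc a) (suc b) (s≤s z≤n) a<b b≤ b≢1+a)

    -- Repeatedly shortening the path to a chord from the apex reaches the second vertex.
    apex-adjacent-second : ∀ {q f z} → InducedPath q f → OffPath q f z →
                           R z (f 1) → 2 ≤ q → R z (f q) → R z (f 2)
    apex-adjacent-second {q} {f} {z} P off z1 = <-rec Goal shorten q P off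
      where
      Goal : ℕ → Set
      Goal m = InducedPath m f → OffPath m f z → 2 ≤ m → R z (f m) → R z (f 2)
      shorten : ∀ m → (∀ {k} → k < m → Goal k) → Goal m
      shorten m rec Pm offm 2≤m zm with m ≟N 2
      ... | yes refl = zm
      ... | no  m≢2  with apex-inner-neighbour (≤∧≢⇒< 2≤m (m≢2 ∘ sym)) Pm offm z1 zm
      ...   | k , 2≤k , k<m , zk =
        rec k<m (InducedPath-prefix k (<⇒≤ k<m) Pm) (λ a 1≤a a≤k → offm a 1≤a (≤-trans a≤k (<⇒≤ k<m))) 2≤k zk

    -- The cycle z₁ f₁ … fₚ z₂ has a chord; inducedness and the non-adjacencies leave only the stated ones.
    bridged-path-chord : ∀ {p f z₁ z₂} → 2 ≤ p → InducedPath p f → OffPath p f z₁ → OffPath p f z₂ →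
                         z₁ ≢ z₂ → R z₁ z₂ → R z₁ (f 1) → R z₂ (f p) → ¬ R z₁ (f p) → ¬ R z₂ (f 1) →
                         Σ ℕ λ k → 2 ≤ k × k < p × (R z₁ (f k) ⊎ R z₂ (f k))
    bridged-path-chord {p} {f} {z₁} {z₂} 2≤p P off₁ off₂ z₁≢z₂ z₁z₂ z₁f₁ z₂fₚ ¬z₁fₚ ¬z₂f₁ =
      fromChord (chordal (suc p) g (s≤s 2≤p) cycle)
      where
      g : ℕ → V
      g = bridged p f z₁ z₂
      position : ∀ k → k ≤ suc p → BridgedPosition p f z₁ z₂ k (g k)
      position = bridged-position p f z₁ z₂
      g-injective : ∀ a b → a ≤ suc p → b ≤ suc p → g a ≡ g b → a ≡ b
      g-injective a b a≤ b≤ eq with position a a≤ | position b b≤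
      ... | at-start a≡0 _       | at-start b≡0 _       = trans a≡0 (sym b≡0)
      ... | at-start _ ga        | in-path 1≤b b≤p gb = contradiction (trans (sym ga) (trans eq gb)) (off₁ b 1≤b b≤p)
      ... | at-start _ ga        | at-end _ gb         = contradiction (trans (sym ga) (trans eq gb)) z₁≢z₂
      ... | in-path 1≤a a≤p ga | at-start _ gb        = contradiction (trans (sym gb) (trans (sym eq) ga)) (off₁ a 1≤a a≤p)
      ... | in-path 1≤a a≤p ga | in-path 1≤b b≤p gb = InducedPath.injective P a b 1≤a a≤p 1≤b b≤p (trans (sym ga) (trans eq gb))
      ... | in-path 1≤a a≤p ga | at-end _ gb         = contradiction (trans (sym gb) (trans (sym eq) ga)) (off₂ a 1≤a a≤p)
      ... | at-end _ ga         | at-start _ gb        = contradiction (trans (sym gb) (trans (sym eq) ga)) z₁≢z₂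
      ... | at-end _ ga         | in-path 1≤b b≤p gb = contradiction (trans (sym ga) (trans eq gb)) (off₂ b 1≤b b≤p)
      ... | at-end a≡ _         | at-end b≡ _         = trans a≡ (sym b≡)
      g-edge : ∀ a → a < suc p → R (g a) (g (suc a))
      g-edge a a<1+p with position a (<⇒≤ a<1+p)
      ... | at-start refl _ = subst (R z₁) (sym (bridged-middle p f z₁ z₂ 1 ≤-refl (≤-trans (s≤s z≤n) 2≤p))) z₁f₁
      ... | at-end refl _   = contradiction a<1+p (<-irrefl refl)
      ... | in-path 1≤a a≤p ga with m≤n⇒m<n∨m≡n a≤p
      ...   | inj₁ a<p = subst₂ R (sym ga) (sym (bridged-middle p f z₁ z₂ (suc a) (s≤s z≤n) a<p)) (InducedPath.edge P a 1≤a a<p)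
      ...   | inj₂ refl = subst₂ R (sym ga) (sym (bridged-last p f z₁ z₂)) (R-sym z₂fₚ)
      cycle : Cycle (suc p) g
      cycle = record { injective = g-injective ; edge = g-edge ; close = subst (λ w → R w z₁) (sym (bridged-last p f z₁ z₂)) (R-sym z₁z₂) }
      fromChord : Chord (suc p) g → Σ ℕ λ k → 2 ≤ k × k < p × (R z₁ (f k) ⊎ R z₂ (f k))
      fromChord (a , b , a<b , b≤ , b≢1+a , ¬ends , Rab) with position a (<⇒≤ (≤-trans a<b b≤)) | position b b≤
      ... | _                | at-start refl _    = contradiction a<b λ ()
      ... | at-end refl _    | _                  = contradiction (≤-trans a<b b≤) (<-irrefl refl)
      ... | at-start refl _  | at-end b≡ _        = contradiction (refl , b≡) ¬ends
      ... | at-start refl ga | in-path 1≤b b≤p gb with b ≟N p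
      ...   | yes refl = contradiction (subst₂ R ga gb Rab) ¬z₁fₚ
      ...   | no  b≢p  = b , ≤∧≢⇒< 1≤b (b≢1+a ∘ sym) , ≤∧≢⇒< b≤p b≢p , inj₁ (subst₂ R ga gb Rab)
      fromChord (a , b , a<b , b≤ , b≢1+a , ¬ends , Rab) | in-path 1≤a _ ga | in-path _ b≤p gb =
        contradiction (subst₂ R ga gb Rab) (InducedPath.induced P a b 1≤a a<b b≤p b≢1+a)
      fromChord (a , b , a<b , b≤ , b≢1+a , ¬ends , Rab) | in-path 1≤a a≤p ga | at-end refl gb with a ≟N 1 | a ≟N p
      ... | _        | yes refl = contradiction refl b≢1+a
      ... | yes refl | no  _    = contradiction (R-sym (subst₂ R ga gb Rab)) ¬z₂f₁
      ... | no  a≢1  | no  a≢p  = a , ≤∧≢⇒< 1≤a (a≢1 ∘ sym) , ≤∧≢⇒< a≤p a≢p , inj₂ (R-sym (subst₂ R ga gb Rab))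

    chordless-square-impossible : ∀ {a b c d} → a ≢ b → a ≢ c → a ≢ d → b ≢ c → d ≢ b → d ≢ c →
                                  R a b → R b c → R c d → R d a → ¬ R a c → ¬ R d b → ⊥
    chordless-square-impossible {a} {b} {c} {d} a≢b a≢c a≢d b≢c d≢b d≢c ab bc cd da ¬ac ¬db
      = no-inner-index (bridged-path-chord {f = path} ≤-refl induced off-a off-d a≢d (R-sym da) ab (R-sym cd) ¬ac ¬db)
      where
      path : ℕ → V
      path 1 = b
      path _ = c
      induced : InducedPath 2 path
      induced = record
        { injective = λ { 1 1 _ _ _ _ _ → refl ; 2 2 _ _ _ _ _ → refl
                        ; 1 2 _ _ _ _ eq → contradiction eq b≢c ; 2 1 _ _ _ _ eq → contradiction (sym eq) b≢c
                        ; (suc (suc (suc _))) _ _ (s≤s (s≤s ())) _ _ _ ; _ (suc (suc (suc _))) _ _ _ (s≤s (s≤s ())) _ }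
        ; edge      = λ { 1 _ _ → bc ; (suc (suc _)) _ (s≤s (s≤s ())) }
        ; induced   = λ { 1 2 _ _ _ 2≢2 _ → 2≢2 refl ; 1 (suc (suc (suc _))) _ _ (s≤s (s≤s ())) _ _
                        ; (suc (suc _)) (suc (suc (suc _))) _ _ (s≤s (s≤s ())) _ _
                        ; (suc (suc _)) 2 _ (s≤s (s≤s ())) _ _ _ ; (suc _) 1 _ (s≤s ()) _ _ _ ; (suc _) 0 _ () _ _ _ } }
      off-a : OffPath 2 path a
      off-a = λ { 1 _ _ → a≢b ; 2 _ _ → a≢c ; (suc (suc (suc _))) _ (s≤s (s≤s ())) }
      off-d : OffPath 2 path d
      off-d = λ { 1 _ _ → d≢b ; 2 _ _ → d≢c ; (suc (suc (suc _))) _ (s≤s (s≤s ())) }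
      no-inner-index : (Σ ℕ λ k → 2 ≤ k × k < 2 × (R a (path k) ⊎ R d (path k))) → ⊥
      no-inner-index (k , 2≤k , k<2 , _) = <-irrefl refl (≤-trans k<2 2≤k)

-- Chordality of the shift

Adj? : ∀ {n} (G : Graph n) u v → Dec (Adj G u v)
Adj? G u v = G (pair u v) ≟B true

-- Saturates above p; only its values on k ≤ p are ever used.
clamp : (p k : ℕ) → Fin (suc p)
clamp p       zero    = zero
clamp zero    (suc k) = zero
clamp (suc p) (suc k) = suc (clamp p k)

toℕ-clamp : ∀ p k → k ≤ p → toℕ (clamp p k) ≡ k
toℕ-clamp p       zero    _         = refl
toℕ-clamp (suc p) (suc k) (s≤s k≤p) = cong suc (toℕ-clamp p k k≤p)

module _ {n : ℕ} (G : Graph n) where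
  open Cycles (Adj G)

  Chordal⇒ChordalRel : Chordal G → ChordalRel
  Chordal⇒ChordalRel chordal p f 3≤p cycle = fromHasChord (chordal p v 3≤p isCycle)
    where
    v : Fin (suc p) → Fin n
    v = f ∘ toℕ
    isCycle : IsCycle G p v
    isCycle = record
      { distinct = λ {a} {b} eq → toℕ-injective (Cycle.injective cycle (toℕ a) (toℕ b) (toℕ≤pred[n] a) (toℕ≤pred[n] b) eq)
      ; step     = λ a b b≡1+a → subst (λ k → Adj G (v a) (f k)) (sym b≡1+a)
                                   (Cycle.edge cycle (toℕ a) (subst (_≤ p) b≡1+a (toℕ≤pred[n] b)))
      ; close    = subst (λ k → Adj G (f k) (f 0)) (sym (toℕ-fromℕ p)) (Cycle.close cycle) }
    endpoints : ∀ {a b : Fin (suc p)} → toℕ a ≡ 0 → toℕ b ≡ p → a ≡ zero × b ≡ fromℕ p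
    endpoints a≡0 b≡p = toℕ-injective a≡0 , toℕ-injective (trans b≡p (sym (toℕ-fromℕ p)))
    fromHasChord : HasChord G p v → Chord p f
    fromHasChord (a , b , a≢b , ¬consec , ab) with <-cmp (toℕ a) (toℕ b)
    ... | tri≈ _ a≡b _ = contradiction (toℕ-injective a≡b) a≢b
    ... | tri< a<b _ _ = toℕ a , toℕ b , a<b , toℕ≤pred[n] b , ¬consec ∘ inj₁ ,
                         (λ (a≡0 , b≡p) → ¬consec (inj₂ (inj₂ (inj₁ (endpoints a≡0 b≡p))))) , ab
    ... | tri> _ _ b<a = toℕ b , toℕ a , b<a , toℕ≤pred[n] a , ¬consec ∘ inj₂ ∘ inj₁ ,
                         (λ (b≡0 , a≡p) → ¬consec (inj₂ (inj₂ (inj₂ (endpoints b≡0 a≡p))))) , Adj-sym G ab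

  IsCycle⇒Cycle : ∀ p (v : Fin (suc p) → Fin n) → IsCycle G p v → Cycle p (v ∘ clamp p)
  IsCycle⇒Cycle p v isCycle = record { injective = clamped-injective ; edge = clamped-edge ; close = clamped-close }
    where
    clamped-injective : ∀ a b → a ≤ p → b ≤ p → v (clamp p a) ≡ v (clamp p b) → a ≡ b
    clamped-injective a b a≤p b≤p eq =
      trans (sym (toℕ-clamp p a a≤p)) (trans (cong toℕ (IsCycle.distinct isCycle eq)) (toℕ-clamp p b b≤p))
    clamped-edge : ∀ a → a < p → Adj G (v (clamp p a)) (v (clamp p (suc a)))
    clamped-edge a a<p = IsCycle.step isCycle (clamp p a) (clamp p (suc a))
                           (trans (toℕ-clamp p (suc a) a<p) (cong suc (sym (toℕ-clamp p a (<⇒≤ a<p)))))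
    clamped-close : Adj G (v (clamp p p)) (v (clamp p 0))
    clamped-close rewrite toℕ-injective (trans (toℕ-clamp p p ≤-refl) (sym (toℕ-fromℕ p))) = IsCycle.close isCycle

  Chord⇒HasChord : ∀ p (v : Fin (suc p) → Fin n) → Chord p (v ∘ clamp p) → HasChord G p v
  Chord⇒HasChord p v (a , b , a<b , b≤p , b≢1+a , ¬ends , ab) = clamp p a , clamp p b , a≢b , ¬consec , ab
    where
    ta : toℕ (clamp p a) ≡ a
    ta = toℕ-clamp p a (<⇒≤ (≤-trans a<b b≤p))
    tb : toℕ (clamp p b) ≡ b
    tb = toℕ-clamp p b b≤p
    a≢b : clamp p a ≢ clamp p b
    a≢b eq = <-irrefl (trans (sym ta) (trans (cong toℕ eq) tb)) a<b
    ¬consec : ¬ CycConsec (clamp p a) (clamp p b)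
    ¬consec (inj₁ eq) = b≢1+a (trans (sym tb) (trans eq (cong suc ta)))
    ¬consec (inj₂ (inj₁ eq)) with trans (sym ta) (trans eq (cong suc tb))
    ... | refl = <-irrefl refl (≤-trans (n≤1+n (suc b)) a<b)
    ¬consec (inj₂ (inj₂ (inj₁ (a≡0 , b≡p)))) =
      ¬ends (trans (sym ta) (cong toℕ a≡0) , trans (sym tb) (trans (cong toℕ b≡p) (toℕ-fromℕ p)))
    ¬consec (inj₂ (inj₂ (inj₂ (b≡0 , _)))) =
      <-irrefl refl (≤-trans a<b (subst (_≤ a) (trans (sym (cong toℕ b≡0)) tb) z≤n))

3≤⇒1< : ∀ {p} → 3 ≤ p → 1 < p
3≤⇒1< (s≤s (s≤s (s≤s _))) = s≤s (s≤s z≤n)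

3≤⇒2≤ : ∀ {p} → 3 ≤ p → 2 ≤ p
3≤⇒2≤ (s≤s (s≤s (s≤s _))) = s≤s (s≤s z≤n)

3≤⇒≢1 : ∀ {p} → 3 ≤ p → p ≢ 1
3≤⇒≢1 (s≤s (s≤s (s≤s _))) ()

3≤⇒≢2 : ∀ {p} → 3 ≤ p → p ≢ 2
3≤⇒≢2 (s≤s (s≤s (s≤s _))) ()

module ShiftChordality {n : ℕ} (G : Graph n) (chordal : Chordal G) {i j : Fin n} (i≢j : i ≢ j) (ij : Adj G i j) where

  private
    H : Graph n
    H = Shift G i j

  open ShiftAdjacency G i≢j
  module CH = Cycles (Adj H)
  module CG = Cycles (Adj G)
  open CG using (InducedPath)

  H-sym : ∀ {u v} → Adj H u v → Adj H v u
  H-sym = Adj-sym H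
  open CG.ChordalRelProperties (Adj-sym G) (Chordal⇒ChordalRel G chordal)

  chordless⇒InducedPath : ∀ {p g} → CH.Cycle p g → CH.Chordless p g → OffPath p g i → OffPath p g j → InducedPath p g
  chordless⇒InducedPath {p} {g} cycle chordless off-i off-j = record
    { injective = λ a b _ a≤p _ b≤p → CH.Cycle.injective cycle a b a≤p b≤p
    ; edge      = λ a 1≤a a<p → adj⁻-avoiding-ij (≢i a 1≤a (<⇒≤ a<p)) (≢j a 1≤a (<⇒≤ a<p))
                                   (≢i (suc a) (s≤s z≤n) a<p) (≢j (suc a) (s≤s z≤n) a<p) (CH.Cycle.edge cycle a a<p)
    ; induced   = λ a b 1≤a a<b b≤p b≢1+a ab → chordless a b a<b b≤p b≢1+a (λ (a≡0 , _) → <-irrefl (sym a≡0) 1≤a)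
                    (adj⁺-avoiding-j (≢j a 1≤a (<⇒≤ (≤-trans a<b b≤p))) (≢j b (≤-trans (s≤s z≤n) a<b) b≤p) ab) }
    where
    ≢i : ∀ a → 1 ≤ a → a ≤ p → g a ≢ i
    ≢i a 1≤a a≤p = ≢-sym (off-i a 1≤a a≤p)
    ≢j : ∀ a → 1 ≤ a → a ≤ p → g a ≢ j
    ≢j a 1≤a a≤p = ≢-sym (off-j a 1≤a a≤p)

  -- If i = g t, then i j, i gₚ or i g₁ is a chord (t ∉ {1, p}, t = 1, t = p); otherwise i and j are both
  -- G-adjacent to g₁ and gₚ, so by the fan lemma to g₂, and then j g₂ is a chord.
  chordless-through-j : ∀ {p g} → 3 ≤ p → CH.Cycle p g → CH.Chordless p g → g 0 ≡ j → ⊥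
  chordless-through-j {p} {g} 3≤p cycle chordless g0≡j = bySearch (search≤ (λ t → g t ≟F i) p)
    where
    off-j : OffPath p g j
    off-j = subst (OffPath p g) g0≡j (CH.start-off-path cycle)
    ≢j : ∀ a → 1 ≤ a → a ≤ p → g a ≢ j
    ≢j a 1≤a a≤p = ≢-sym (off-j a 1≤a a≤p)
    1<p : 1 < p
    1<p = 3≤⇒1< 3≤p
    first-edge : Adj H j (g 1)
    first-edge = subst (λ w → Adj H w (g 1)) g0≡j (CH.Cycle.edge cycle 0 (<⇒≤ 1<p))
    last-edge : Adj H j (g p)
    last-edge = H-sym (subst (Adj H (g p)) g0≡j (CH.Cycle.close cycle))
    no-chord-1p : ¬ Adj H (g 1) (g p)
    no-chord-1p = chordless 1 p 1<p ≤-refl (3≤⇒≢2 3≤p) (λ { (() , _) })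
    bySearch : (Σ ℕ λ t → t ≤ p × g t ≡ i) ⊎ (∀ t → t ≤ p → g t ≢ i) → ⊥
    bySearch (inj₁ (t , t≤p , gt≡i)) with t ≟N 1 | t ≟N p
    ... | yes refl | _        = no-chord-1p (subst (λ w → Adj H w (g p)) (sym gt≡i) (adj⁺-avoiding-j i≢j (≢j p (<⇒≤ 1<p) ≤-refl) i-gp))
      where
      gp≢i : g p ≢ i
      gp≢i gp≡i = 3≤⇒≢1 3≤p (CH.Cycle.injective cycle p 1 ≤-refl (<⇒≤ 1<p) (trans gp≡i (sym gt≡i)))
      i-gp : Adj G i (g p)
      i-gp = proj₂ (adj⁻-j gp≢i (≢j p (<⇒≤ 1<p) ≤-refl) last-edge)
    ... | no _     | yes refl = no-chord-1p (subst (Adj H (g 1)) (sym gt≡i) (H-sym (adj⁺-avoiding-j i≢j (≢j 1 ≤-refl (<⇒≤ 1<p)) i-g1)))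
      where
      g1≢i : g 1 ≢ i
      g1≢i g1≡i = 3≤⇒≢1 3≤p (CH.Cycle.injective cycle p 1 ≤-refl (<⇒≤ 1<p) (trans gt≡i (sym g1≡i)))
      i-g1 : Adj G i (g 1)
      i-g1 = proj₂ (adj⁻-j g1≢i (≢j 1 ≤-refl (<⇒≤ 1<p)) first-edge)
    ... | no t≢1   | no t≢p   = chordless 0 t 0<t t≤p t≢1 (t≢p ∘ proj₂) (subst₂ (Adj H) (sym g0≡j) (sym gt≡i) (H-sym (adj⁺-ij ij)))
      where
      0<t : 0 < t
      0<t = ≤∧≢⇒< z≤n (λ 0≡t → i≢j (trans (sym gt≡i) (trans (cong g (sym 0≡t)) g0≡j)))
    bySearch (inj₂ ≢i) = chordless 0 2 (s≤s z≤n) (3≤⇒2≤ 3≤p) (λ ()) (λ (_ , 2≡p) → 3≤⇒≢2 3≤p (sym 2≡p))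
                           (subst (λ w → Adj H w (g 2)) (sym g0≡j)
                             (adj⁺-j (≢i 2 (3≤⇒2≤ 3≤p)) (≢j 2 (s≤s z≤n) (3≤⇒2≤ 3≤p)) j-g2 i-g2))
      where
      off-i : OffPath p g i
      off-i a _ a≤p = ≢-sym (≢i a a≤p)
      P : InducedPath p g
      P = chordless⇒InducedPath cycle chordless off-i off-j
      g₁-neighbours : Adj G j (g 1) × Adj G i (g 1)
      g₁-neighbours = adj⁻-j (≢i 1 (<⇒≤ 1<p)) (≢j 1 ≤-refl (<⇒≤ 1<p)) first-edge
      gₚ-neighbours : Adj G j (g p) × Adj G i (g p)
      gₚ-neighbours = adj⁻-j (≢i p ≤-refl) (≢j p (<⇒≤ 1<p) ≤-refl) last-edge
      j-g2 : Adj G j (g 2)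
      j-g2 = apex-adjacent-second P off-j (proj₁ g₁-neighbours) (3≤⇒2≤ 3≤p) (proj₁ gₚ-neighbours)
      i-g2 : Adj G i (g 2)
      i-g2 = apex-adjacent-second P off-i (proj₂ g₁-neighbours) (3≤⇒2≤ 3≤p) (proj₂ gₚ-neighbours)

  -- Each of g₁, gₚ is a G-neighbour of i or of j; a fan from i or j, or the chord of the cycle i g₁ … gₚ j,
  -- yields a G-edge from i or j to some gₖ with 2 ≤ k < p, which is an H-chord at i.
  chordless-through-i-only : ∀ {p g} → 3 ≤ p → CH.Cycle p g → CH.Chordless p g → g 0 ≡ i → (∀ a → a ≤ p → g a ≢ j) → ⊥
  chordless-through-i-only {p} {g} 3≤p cycle chordless g0≡i ≢j = byAdjacency (Adj? G i (g 1)) (Adj? G i (g p))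
    where
    off-i : OffPath p g i
    off-i = subst (OffPath p g) g0≡i (CH.start-off-path cycle)
    off-j : OffPath p g j
    off-j a _ a≤p = ≢-sym (≢j a a≤p)
    ≢i : ∀ a → 1 ≤ a → a ≤ p → g a ≢ i
    ≢i a 1≤a a≤p = ≢-sym (off-i a 1≤a a≤p)
    1≤p : 1 ≤ p
    1≤p = <⇒≤ (3≤⇒1< 3≤p)
    2≤p : 2 ≤ p
    2≤p = 3≤⇒2≤ 3≤p
    P : InducedPath p g
    P = chordless⇒InducedPath cycle chordless off-i off-j
    g₁-neighbour : Adj G i (g 1) ⊎ Adj G j (g 1)
    g₁-neighbour = adj⁻-i (≢i 1 ≤-refl 1≤p) (≢j 1 1≤p) (subst (λ w → Adj H w (g 1)) g0≡i (CH.Cycle.edge cycle 0 1≤p))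
    gₚ-neighbour : Adj G i (g p) ⊎ Adj G j (g p)
    gₚ-neighbour = adj⁻-i (≢i p 1≤p ≤-refl) (≢j p ≤-refl) (H-sym (subst (Adj H (g p)) g0≡i (CH.Cycle.close cycle)))
    no-inner-neighbour : ∀ k → 2 ≤ k → k < p → ¬ (Adj G i (g k) ⊎ Adj G j (g k))
    no-inner-neighbour k 2≤k k<p G-edge = chordless 0 k (≤-trans (s≤s z≤n) 2≤k) (<⇒≤ k<p) (λ k≡1 → <-irrefl (sym k≡1) 2≤k)
                                            (λ (_ , k≡p) → <-irrefl k≡p k<p) (subst (λ w → Adj H w (g k)) (sym g0≡i) (H-edge G-edge))
      where
      1≤k : 1 ≤ k
      1≤k = ≤-trans (s≤s z≤n) 2≤k
      H-edge : Adj G i (g k) ⊎ Adj G j (g k) → Adj H i (g k)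
      H-edge (inj₁ i-gk) = adj⁺-avoiding-j i≢j (≢j k (<⇒≤ k<p)) i-gk
      H-edge (inj₂ j-gk) = adj⁺-i (≢i k 1≤k (<⇒≤ k<p)) (≢j k (<⇒≤ k<p)) j-gk
    fan-i : Adj G i (g 1) → Adj G i (g p) → ⊥
    fan-i i-g1 i-gp = no-inner-neighbour 2 ≤-refl 3≤p (inj₁ (apex-adjacent-second P off-i i-g1 2≤p i-gp))
    fan-j : Adj G j (g 1) → Adj G j (g p) → ⊥
    fan-j j-g1 j-gp = no-inner-neighbour 2 ≤-refl 3≤p (inj₂ (apex-adjacent-second P off-j j-g1 2≤p j-gp))
    inner-chord : (Σ ℕ λ k → 2 ≤ k × k < p × (Adj G i (g k) ⊎ Adj G j (g k))) → ⊥
    inner-chord (k , 2≤k , k<p , chord) = no-inner-neighbour k 2≤k k<p chord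
    inner-chord′ : (Σ ℕ λ k → 2 ≤ k × k < p × (Adj G j (g k) ⊎ Adj G i (g k))) → ⊥
    inner-chord′ (k , 2≤k , k<p , inj₁ j-gk) = no-inner-neighbour k 2≤k k<p (inj₂ j-gk)
    inner-chord′ (k , 2≤k , k<p , inj₂ i-gk) = no-inner-neighbour k 2≤k k<p (inj₁ i-gk)
    byAdjacency : Dec (Adj G i (g 1)) → Dec (Adj G i (g p)) → ⊥
    byAdjacency (yes i-g1) (yes i-gp) = fan-i i-g1 i-gp
    byAdjacency (yes i-g1) (no ¬i-gp) = byJ (Adj? G j (g 1))
      where
      j-gp : Adj G j (g p)
      j-gp = ⊎-resolveʳ gₚ-neighbour ¬i-gp
      byJ : Dec (Adj G j (g 1)) → ⊥
      byJ (yes j-g1) = fan-j j-g1 j-gp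
      byJ (no ¬j-g1) = inner-chord (bridged-path-chord 2≤p P off-i off-j i≢j ij i-g1 j-gp ¬i-gp ¬j-g1)
    byAdjacency (no ¬i-g1) (yes i-gp) = byJ (Adj? G j (g p))
      where
      j-g1 : Adj G j (g 1)
      j-g1 = ⊎-resolveʳ g₁-neighbour ¬i-g1
      byJ : Dec (Adj G j (g p)) → ⊥
      byJ (yes j-gp) = fan-j j-g1 j-gp
      byJ (no ¬j-gp) = inner-chord′ (bridged-path-chord 2≤p P off-j off-i (i≢j ∘ sym) (Adj-sym G ij) j-g1 i-gp ¬j-gp ¬i-g1)
    byAdjacency (no ¬i-g1) (no ¬i-gp) = fan-j (⊎-resolveʳ g₁-neighbour ¬i-g1) (⊎-resolveʳ gₚ-neighbour ¬i-gp)

  chordless-avoiding-ij : ∀ {p g} → 3 ≤ p → CH.Cycle p g → CH.Chordless p g →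
                          (∀ a → a ≤ p → g a ≢ i) → (∀ a → a ≤ p → g a ≢ j) → ⊥
  chordless-avoiding-ij {p} {g} 3≤p cycle chordless ≢i ≢j = toH-chord (Chordal⇒ChordalRel G chordal p g 3≤p G-cycle)
    where
    G-cycle : CG.Cycle p g
    G-cycle = record
      { injective = CH.Cycle.injective cycle
      ; edge      = λ a a<p → adj⁻-avoiding-ij (≢i a (<⇒≤ a<p)) (≢j a (<⇒≤ a<p)) (≢i (suc a) a<p) (≢j (suc a) a<p)
                                               (CH.Cycle.edge cycle a a<p)
      ; close     = adj⁻-avoiding-ij (≢i p ≤-refl) (≢j p ≤-refl) (≢i 0 z≤n) (≢j 0 z≤n) (CH.Cycle.close cycle) }
    toH-chord : CG.Chord p g → ⊥
    toH-chord (a , b , a<b , b≤p , b≢1+a , ¬ends , ab) =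
      chordless a b a<b b≤p b≢1+a ¬ends (adj⁺-avoiding-j (≢j a (<⇒≤ (≤-trans a<b b≤p))) (≢j b b≤p) ab)

  chordless-cycle-impossible : ∀ {p g} → 3 ≤ p → CH.Cycle p g → CH.Chordless p g → ⊥
  chordless-cycle-impossible {p} {g} 3≤p cycle chordless with search≤ (λ t → g t ≟F j) p
  ... | inj₁ (t , t≤p , gt≡j) = chordless-through-j 3≤p (CH.rotate-Cycle t cycle) (CH.rotate-Chordless H-sym t chordless)
                                  (trans (cong g (CH.rotate-zero p t t≤p)) gt≡j)
  ... | inj₂ ≢j with search≤ (λ t → g t ≟F i) p
  ...   | inj₁ (t , t≤p , gt≡i) = chordless-through-i-only 3≤p (CH.rotate-Cycle t cycle) (CH.rotate-Chordless H-sym t chordless)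
                                    (trans (cong g (CH.rotate-zero p t t≤p)) gt≡i) (λ a a≤p → ≢j (CH.rotate p t a) (CH.rotate-≤ p t a a≤p))
  ...   | inj₂ ≢i = chordless-avoiding-ij 3≤p cycle chordless ≢i ≢j

  Shift-chordal : Chordal H
  Shift-chordal p v 3≤p isCycle with CH.chord? (Adj? H) p (v ∘ clamp p)
  ... | inj₁ chord     = Chord⇒HasChord H p v chord
  ... | inj₂ chordless = ⊥-elim (chordless-cycle-impossible 3≤p (IsCycle⇒Cycle H p v isCycle) chordless)

-- Connectivity of the shift

∉⇒lookup≡false : ∀ {n} {X : Subset n} {x} → x ∉ X → lookup X x ≡ false
∉⇒lookup≡false {X = X} {x} x∉X = ¬-not (x∉X ∘ lookup⇒[]= x X)

lookup≡false⇒∉ : ∀ {n} {X : Subset n} {x} → lookup X x ≡ false → x ∉ X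
lookup≡false⇒∉ Xx x∈X = true≢false (trans (sym ([]=⇒lookup x∈X)) Xx)

lookup≡true⇒∉⇒≢ : ∀ {n} {X : Subset n} {x y} → lookup X y ≡ true → x ∉ X → x ≢ y
lookup≡true⇒∉⇒≢ Xy x∉X refl = true≢false (trans (sym Xy) (∉⇒lookup≡false x∉X))

module _ {n : ℕ} {X : Subset n} where

  Path-++ : ∀ {G : Graph n} {u w v} → Path G X u w → Path G X w v → Path G X u v
  Path-++ (here _)        q = q
  Path-++ (step u∉X uw p) q = step u∉X uw (Path-++ p q)

  Path-head∉ : ∀ {G : Graph n} {u v} → Path G X u v → u ∉ X
  Path-head∉ (here u∉X)     = u∉X
  Path-head∉ (step u∉X _ _) = u∉X

  Path-edge : ∀ {G : Graph n} {u v} → u ∉ X → v ∉ X → Adj G u v → Path G X u v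
  Path-edge u∉X v∉X uv = step u∉X uv (here v∉X)

  Path-reverse : ∀ {G : Graph n} {u v} → (∀ {a b} → Adj G a b → Adj G b a) → Path G X u v → Path G X v u
  Path-reverse G-sym (here u∉X)      = here u∉X
  Path-reverse G-sym (step u∉X uw p) = Path-++ (Path-reverse G-sym p) (Path-edge (Path-head∉ p) u∉X (G-sym uw))

  Path-map : ∀ {G G′ : Graph n} {u v} → (∀ {a b} → a ∉ X → b ∉ X → Adj G a b → Path G′ X a b) →
             Path G X u v → Path G′ X u v
  Path-map edge (here u∉X)       = here u∉X
  Path-map edge (step u∉X uw p) = Path-++ (edge u∉X (Path-head∉ p) uw) (Path-map edge p)

_◃_ : ∀ {A : Set} → A → (ℕ → A) → ℕ → A
(a ◃ u) zero    = a
(a ◃ u) (suc k) = u k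

module _ {A : Set} (a d : ℕ) (u : ℕ → A) where
  private
    pick : ∀ k → Dec (k ≤ a) → A
    pick k (yes _) = u k
    pick k (no  _) = u (k + d)

  skip : ℕ → A
  skip k = pick k (k ≤? a)

  skip-≤ : ∀ {k} → k ≤ a → skip k ≡ u k
  skip-≤ {k} k≤a with k ≤? a
  ... | yes _   = refl
  ... | no  k≰a = contradiction k≤a k≰a

  skip-> : ∀ {k} → a < k → skip k ≡ u (k + d)
  skip-> {k} a<k with k ≤? a
  ... | yes k≤a = contradiction (≤-<-trans k≤a a<k) (<-irrefl refl)
  ... | no  _   = refl

  skip-cases : ∀ k → (k ≤ a × skip k ≡ u k) ⊎ (a < k × skip k ≡ u (k + d))
  skip-cases k with k ≤? a
  ... | yes k≤a = inj₁ (k≤a , refl)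
  ... | no  k≰a = inj₂ (≰⇒> k≰a , refl)

module ShiftConnectivity {n : ℕ} (G : Graph n) (simple : IsSimpleGraph G) (chordal : Chordal G)
                         {i j : Fin n} (i≢j : i ≢ j) (ij : Adj G i j) where

  private
    H : Graph n
    H = Shift G i j

  H-sym : ∀ {u v} → Adj H u v → Adj H v u
  H-sym = Adj-sym H

  open ShiftAdjacency G i≢j
  open Swap i≢j
  open Cycles (Adj G) using (Cycle; Chordless; chord?; ChordalRel; Chord⇒¬Chordless)

  G-chordal : ChordalRel
  G-chordal = Chordal⇒ChordalRel G chordal

  module ViaCommonNeighbour (X : Subset n) (i∈X : lookup X i ≡ true) (j∉X : j ∉ X) (x : Fin n) where

    Reaches : Fin n → Set
    Reaches v = v ∉ X × v ≢ j × Path H X v x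

    record JIWalk (m : ℕ) (u : ℕ → Fin n) : Set where
      field
        start   : u 0 ≡ j
        end     : u (suc m) ≡ i
        reaches : ∀ k → 1 ≤ k → k ≤ m → Reaches (u k)
        steps   : ∀ k → k ≤ m → Adj G (u k) (u (suc k))

    CommonNeighbour : Set
    CommonNeighbour = Σ (Fin n) λ c → Reaches c × Adj G j c × Adj G i c

    shortcut : ∀ a d r {u} → JIWalk (a + d + r) u → Adj G (u a) (u (suc (a + d))) → JIWalk (a + r) (skip a d u)
    shortcut a d r {u} W chord = record { start = start ; end = end ; reaches = reaches ; steps = steps }
      where
      a+r+d≡a+d+r : a + r + d ≡ a + d + r
      a+r+d≡a+d+r = trans (+-assoc a r d) (trans (cong (a +_) (+-comm r d)) (sym (+-assoc a d r)))
      a≤m : a ≤ a + d + r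
      a≤m = ≤-trans (m≤m+n a d) (m≤m+n (a + d) r)
      shifted≤m : ∀ {k} → k ≤ a + r → k + d ≤ a + d + r
      shifted≤m {k} k≤a+r = subst (k + d ≤_) a+r+d≡a+d+r (+-monoˡ-≤ d k≤a+r)
      start : skip a d u 0 ≡ j
      start = trans (skip-≤ a d u z≤n) (JIWalk.start W)
      end : skip a d u (suc (a + r)) ≡ i
      end = trans (skip-> a d u (s≤s (m≤m+n a r))) (trans (cong (u ∘ suc) a+r+d≡a+d+r) (JIWalk.end W))
      reaches : ∀ k → 1 ≤ k → k ≤ a + r → Reaches (skip a d u k)
      reaches k 1≤k k≤a+r with skip-cases a d u k
      ... | inj₁ (k≤a , eq) = subst Reaches (sym eq) (JIWalk.reaches W k 1≤k (≤-trans k≤a a≤m))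
      ... | inj₂ (_   , eq) = subst Reaches (sym eq) (JIWalk.reaches W (k + d) (≤-trans 1≤k (m≤m+n k d)) (shifted≤m k≤a+r))
      steps : ∀ k → k ≤ a + r → Adj G (skip a d u k) (skip a d u (suc k))
      steps k k≤a+r with <-cmp k a
      ... | tri< k<a _ _ = subst₂ (Adj G) (sym (skip-≤ a d u (<⇒≤ k<a))) (sym (skip-≤ a d u k<a)) (JIWalk.steps W k (≤-trans (<⇒≤ k<a) a≤m))
      ... | tri≈ _ refl _ = subst₂ (Adj G) (sym (skip-≤ a d u ≤-refl)) (sym (skip-> a d u ≤-refl)) chord
      ... | tri> _ _ a<k = subst₂ (Adj G) (sym (skip-> a d u a<k)) (sym (skip-> a d u (≤-trans a<k (n≤1+n k))))
                             (JIWalk.steps W (k + d) (shifted≤m k≤a+r))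

    JIWalk⇒Cycle : ∀ {m u} → JIWalk m u → Chordless (suc m) u → Cycle (suc m) u
    JIWalk⇒Cycle {m} {u} W chordless = record
      { injective = injective
      ; edge      = λ k k<1+m → JIWalk.steps W k (≤-pred k<1+m)
      ; close     = subst₂ (Adj G) (sym (JIWalk.end W)) (sym (JIWalk.start W)) ij }
      where
      internal≢i : ∀ k → 1 ≤ k → k ≤ m → u k ≢ i
      internal≢i k 1≤k k≤m = lookup≡true⇒∉⇒≢ i∈X (proj₁ (JIWalk.reaches W k 1≤k k≤m))
      internal≢j : ∀ k → 1 ≤ k → k ≤ m → u k ≢ j
      internal≢j k 1≤k k≤m = proj₁ (proj₂ (JIWalk.reaches W k 1≤k k≤m))
      no-repeat : ∀ a b → a < b → b ≤ suc m → u a ≢ u b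
      no-repeat a b a<b b≤1+m eq with m≤n⇒m<n∨m≡n b≤1+m
      no-repeat zero    b _   _ eq | inj₂ refl = i≢j (trans (sym (JIWalk.end W)) (trans (sym eq) (JIWalk.start W)))
      no-repeat (suc a) b a<b _ eq | inj₂ refl = internal≢i (suc a) (s≤s z≤n) (≤-pred a<b) (trans eq (JIWalk.end W))
      no-repeat zero    b 0<b _ eq | inj₁ (s≤s b≤m) = internal≢j b 0<b b≤m (trans (sym eq) (JIWalk.start W))
      no-repeat (suc a) b a<b _ eq | inj₁ (s≤s b≤m) =
        chordless (suc a) (suc b) (≤-trans a<b (n≤1+n b)) (s≤s b≤m) (λ b≡a → <-irrefl (sym (suc-injective b≡a)) a<b) (λ { (() , _) })
          (subst (λ w → Adj G w (u (suc b))) (sym eq) (JIWalk.steps W b b≤m))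
      injective : ∀ a b → a ≤ suc m → b ≤ suc m → u a ≡ u b → a ≡ b
      injective a b a≤ b≤ eq with <-cmp a b
      ... | tri< a<b _ _ = contradiction eq (no-repeat a b a<b b≤)
      ... | tri≈ _ a≡b _ = a≡b
      ... | tri> _ _ b<a = contradiction (sym eq) (no-repeat b a b<a a≤)

    -- A chord of the cycle j, u₁, …, uₘ, i is a shortcut of the walk; a chordless one must be j, u₁, i.
    common-neighbour : ∀ m {u} → 1 ≤ m → JIWalk m u → CommonNeighbour
    common-neighbour = <-rec Goal go
      where
      Goal : ℕ → Set
      Goal m = ∀ {u} → 1 ≤ m → JIWalk m u → CommonNeighbour
      go : ∀ m → (∀ {m′} → m′ < m → Goal m′) → Goal m
      go m rec {u} 1≤m W with chord? (Adj? G) (suc m) u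
      ... | inj₁ (a , b , a<b , b≤1+m , b≢1+a , ¬ends , ab) = rec a+r<m 1≤a+r (shortcut a d r W′ ab′)
        where
        d r : ℕ
        d = b ∸ suc a
        r = suc m ∸ b
        b≡ : suc (a + d) ≡ b
        b≡ = m+[n∸m]≡n a<b
        m≡ : a + d + r ≡ m
        m≡ = suc-injective (trans (cong (_+ r) b≡) (m+[n∸m]≡n b≤1+m))
        W′ : JIWalk (a + d + r) u
        W′ = subst (λ m′ → JIWalk m′ u) (sym m≡) W
        ab′ : Adj G (u a) (u (suc (a + d)))
        ab′ = subst (λ k → Adj G (u a) (u k)) (sym b≡) ab
        1≤d : 1 ≤ d
        1≤d = ≤∧≢⇒< z≤n (λ 0≡d → b≢1+a (trans (sym b≡) (cong suc (trans (cong (a +_) (sym 0≡d)) (+-identityʳ a)))))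
        a+r<m : a + r < m
        a+r<m = subst (a + r <_) m≡ (+-monoˡ-< r (m<m+n a 1≤d))
        1≤a+r : 1 ≤ a + r
        1≤a+r = ≤∧≢⇒< z≤n λ 0≡a+r → ¬ends (m+n≡0⇒m≡0 a (sym 0≡a+r) ,
                  trans (sym (+-identityʳ b)) (trans (cong (b +_) (sym (m+n≡0⇒n≡0 a (sym 0≡a+r)))) (m+[n∸m]≡n b≤1+m)))
      ... | inj₂ chordless with m ≟N 1
      ...   | yes refl = u 1 , JIWalk.reaches W 1 ≤-refl ≤-refl , subst (λ w → Adj G w (u 1)) (JIWalk.start W) (JIWalk.steps W 0 z≤n) ,
                         Adj-sym G (subst (Adj G (u 1)) (JIWalk.end W) (JIWalk.steps W 1 ≤-refl))
      ...   | no  m≢1  =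
        ⊥-elim (Chord⇒¬Chordless (G-chordal (suc m) u (s≤s (≤∧≢⇒< 1≤m (m≢1 ∘ sym))) (JIWalk⇒Cycle W chordless)) chordless)

    record IWalk (m : ℕ) (u : ℕ → Fin n) : Set where
      field
        end     : u (suc m) ≡ i
        reaches : ∀ k → k ≤ m → Reaches (u k)
        steps   : ∀ k → k ≤ m → Adj G (u k) (u (suc k))

    IWalk⇒JIWalk : ∀ {m u} → Adj G j (u 0) → IWalk m u → JIWalk (suc m) (j ◃ u)
    IWalk⇒JIWalk {m} {u} j-u₀ W = record { start = refl ; end = IWalk.end W ; reaches = reaches ; steps = steps }
      where
      reaches : ∀ k → 1 ≤ k → k ≤ suc m → Reaches ((j ◃ u) k)
      reaches (suc k) _ (s≤s k≤m) = IWalk.reaches W k k≤m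
      steps : ∀ k → k ≤ suc m → Adj G ((j ◃ u) k) ((j ◃ u) (suc k))
      steps zero    _         = j-u₀
      steps (suc k) (s≤s k≤m) = IWalk.steps W k k≤m

    ∉swap⇒∉ : ∀ {v} → v ∉ swap X → v ≢ i → v ∉ X × v ≢ j
    ∉swap⇒∉ {v} v∉Y v≢i = v∉X , v≢j
      where
      v≢j : v ≢ j
      v≢j refl = lookup≡true⇒∉⇒≢ (trans (lookup-swap-j X) i∈X) v∉Y refl
      v∉X : v ∉ X
      v∉X = lookup≡false⇒∉ (trans (sym (lookup-swap-other X v≢i v≢j)) (∉⇒lookup≡false v∉Y))

    -- Cut at the first visit of i; the path walked so far, reversed, takes each vertex back to x in H − X.
    Path⇒IWalk : ∀ {v} → Path G (swap X) v i → v ≢ i → Path H X v x → Σ ℕ λ m → Σ (ℕ → Fin n) λ u → u 0 ≡ v × IWalk m u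
    Path⇒IWalk (here _) v≢i _ = contradiction refl v≢i
    Path⇒IWalk {v} (step {w = w} v∉Y vw rest) v≢i v⇝x with ∉swap⇒∉ v∉Y v≢i | w ≟F i
    ... | v∉X , v≢j | yes refl = 0 , v ◃ (λ _ → i) , refl , record { end = refl ; reaches = reaches ; steps = steps }
      where
      reaches : ∀ k → k ≤ 0 → Reaches ((v ◃ (λ _ → i)) k)
      reaches zero _ = v∉X , v≢j , v⇝x
      steps : ∀ k → k ≤ 0 → Adj G ((v ◃ (λ _ → i)) k) ((v ◃ (λ _ → i)) (suc k))
      steps zero _ = vw
    ... | v∉X , v≢j | no w≢i with ∉swap⇒∉ (Path-head∉ rest) w≢i
    ...   | w∉X , w≢j with Path⇒IWalk rest w≢i (step w∉X (adj⁺-avoiding-j w≢j v≢j (Adj-sym G vw)) v⇝x)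
    ...     | m , u , u₀≡w , W = suc m , v ◃ u , refl , record { end = IWalk.end W ; reaches = reaches ; steps = steps }
      where
      reaches : ∀ k → k ≤ suc m → Reaches ((v ◃ u) k)
      reaches zero    _         = v∉X , v≢j , v⇝x
      reaches (suc k) (s≤s k≤m) = IWalk.reaches W k k≤m
      steps : ∀ k → k ≤ suc m → Adj G ((v ◃ u) k) ((v ◃ u) (suc k))
      steps zero    _         = subst (Adj G v) (sym u₀≡w) vw
      steps (suc k) (s≤s k≤m) = IWalk.steps W k k≤m

  -- A path from x to i in G − swap X avoids j and X ∖ {i}; prefixed by j it is a walk j x … i as above.
  j-reaches-via-common-neighbour : ∀ {X : Subset n} → lookup X i ≡ true → j ∉ X → ConnectedMinus G (swap X) →
                                   ∀ {x} → x ∉ X → x ≢ j → Adj G j x → Path H X j x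
  j-reaches-via-common-neighbour {X} i∈X j∉X connected {x} x∉X x≢j jx =
    viaWalk (Path⇒IWalk (connected x i x∉Y i∉Y) x≢i (here x∉X))
    where
    open ViaCommonNeighbour X i∈X j∉X x
    x≢i : x ≢ i
    x≢i = lookup≡true⇒∉⇒≢ i∈X x∉X
    x∉Y : x ∉ swap X
    x∉Y = lookup≡false⇒∉ (trans (lookup-swap-other X x≢i x≢j) (∉⇒lookup≡false x∉X))
    i∉Y : i ∉ swap X
    i∉Y = lookup≡false⇒∉ (trans (lookup-swap-i X) (∉⇒lookup≡false j∉X))
    viaNeighbour : CommonNeighbour → Path H X j x
    viaNeighbour (c , (c∉X , c≢j , c⇝x) , j-c , i-c) = step j∉X (adj⁺-j (lookup≡true⇒∉⇒≢ i∈X c∉X) c≢j j-c i-c) c⇝x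
    viaWalk : (Σ ℕ λ m → Σ (ℕ → Fin n) λ u → u 0 ≡ x × IWalk m u) → Path H X j x
    viaWalk (m , u , u₀≡x , W) = viaNeighbour (common-neighbour (suc m) (s≤s z≤n) (IWalk⇒JIWalk (subst (Adj G j) (sym u₀≡x) jx) W))

  j-reaches-via-i : ∀ {X : Subset n} → i ∉ X → j ∉ X → ∀ {x} → x ∉ X → x ≢ j → Adj G j x → Path H X j x
  j-reaches-via-i i∉X j∉X {x} x∉X x≢j jx with x ≟F i
  ... | yes refl = Path-edge j∉X x∉X (H-sym (adj⁺-ij ij))
  ... | no  x≢i with Adj? G i x
  ...   | yes ix = Path-edge j∉X x∉X (adj⁺-j x≢i x≢j jx ix)
  ...   | no  _  = step j∉X (H-sym (adj⁺-ij ij)) (Path-edge i∉X x∉X (adj⁺-i x≢i x≢j jx))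

  Shift-KConnected : ∀ k → KConnected k G → KConnected k H
  Shift-KConnected k (k<n , connected) = k<n , λ X |X|<k u v u∉X v∉X → Path-map (edge⇒Path X |X|<k) (connected X |X|<k u v u∉X v∉X)
    where
    j-reaches : ∀ X → ∣ X ∣ < k → j ∉ X → ∀ {x} → x ∉ X → x ≢ j → Adj G j x → Path H X j x
    j-reaches X |X|<k j∉X with lookup X i in Xi
    ... | true  = j-reaches-via-common-neighbour Xi j∉X (connected (swap X) (subst (_< k) (sym (∣swap∣ X)) |X|<k))
    ... | false = j-reaches-via-i (lookup≡false⇒∉ Xi) j∉X
    edge⇒Path : ∀ X → ∣ X ∣ < k → ∀ {a b} → a ∉ X → b ∉ X → Adj G a b → Path H X a b
    edge⇒Path X |X|<k {a} {b} a∉X b∉X ab with a ≟F j | b ≟F j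
    ... | yes refl | yes refl = contradiction ab (Adj-irrefl simple)
    ... | yes refl | no  b≢j  = j-reaches X |X|<k a∉X b∉X b≢j ab
    ... | no  a≢j  | yes refl = Path-reverse H-sym (j-reaches X |X|<k b∉X a∉X a≢j (Adj-sym G ab))
    ... | no  a≢j  | no  b≢j  = Path-edge a∉X b∉X (adj⁺-avoiding-j a≢j b≢j ab)

-- Counting cliques

sumOver : ∀ {A : Set} → List A → (A → ℕ) → ℕ
sumOver xs f = sum (map f xs)

sumOver-cong : ∀ {A : Set} xs {f g : A → ℕ} → (∀ x → f x ≡ g x) → sumOver xs f ≡ sumOver xs g
sumOver-cong []       f≗g = refl
sumOver-cong (x ∷ xs) f≗g = cong₂ _+_ (f≗g x) (sumOver-cong xs f≗g)

sumOver-zero : ∀ {A : Set} (xs : List A) → sumOver xs (λ _ → 0) ≡ 0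
sumOver-zero []       = refl
sumOver-zero (x ∷ xs) = sumOver-zero xs

sumOver-+ : ∀ {A : Set} xs (f g : A → ℕ) → sumOver xs (λ x → f x + g x) ≡ sumOver xs f + sumOver xs g
sumOver-+ []       f g = refl
sumOver-+ (x ∷ xs) f g = begin
  (f x + g x) + sumOver xs (λ y → f y + g y) ≡⟨ cong ((f x + g x) +_) (sumOver-+ xs f g) ⟩
  (f x + g x) + (F + G)                      ≡⟨ +-assoc (f x) (g x) (F + G) ⟩
  f x + (g x + (F + G))                      ≡⟨ cong (f x +_) (sym (+-assoc (g x) F G)) ⟩
  f x + ((g x + F) + G)                      ≡⟨ cong (λ t → f x + (t + G)) (+-comm (g x) F) ⟩
  f x + ((F + g x) + G)                      ≡⟨ cong (f x +_) (+-assoc F (g x) G) ⟩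
  f x + (F + (g x + G))                      ≡⟨ sym (+-assoc (f x) F (g x + G)) ⟩
  (f x + F) + (g x + G)                      ∎
  where
  open ≡-Reasoning
  F G : ℕ
  F = sumOver xs f
  G = sumOver xs g

sumOver-*ʳ : ∀ {A : Set} xs (f : A → ℕ) c → sumOver xs (λ x → f x * c) ≡ sumOver xs f * c
sumOver-*ʳ []       f c = refl
sumOver-*ʳ (x ∷ xs) f c = trans (cong (f x * c +_) (sumOver-*ʳ xs f c)) (sym (*-distribʳ-+ c (f x) (sumOver xs f)))

sumOver-comm : ∀ {A B : Set} (xs : List A) (ys : List B) (g : A → B → ℕ) →
               sumOver xs (λ a → sumOver ys (g a)) ≡ sumOver ys (λ b → sumOver xs (λ a → g a b))
sumOver-comm []       ys g = sym (sumOver-zero ys)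
sumOver-comm (x ∷ xs) ys g =
  trans (cong (sumOver ys (g x) +_) (sumOver-comm xs ys g)) (sym (sumOver-+ ys (g x) (λ b → sumOver xs (λ a → g a b))))

sumOver-allSubsets-suc : ∀ n (f : Subset (suc n) → ℕ) →
  sumOver (allSubsets (suc n)) f ≡ sumOver (allSubsets n) (λ A → f (true ∷ A)) + sumOver (allSubsets n) (λ A → f (false ∷ A))
sumOver-allSubsets-suc n f
  rewrite map-++ f (map (true ∷_) (allSubsets n)) (map (false ∷_) (allSubsets n))
        | sum-++ (map f (map (true ∷_) (allSubsets n))) (map f (map (false ∷_) (allSubsets n)))
        | sym (map-∘ {g = f} {f = true ∷_} (allSubsets n))
        | sym (map-∘ {g = f} {f = false ∷_} (allSubsets n)) = refl

δ : ∀ {n} → Subset n → Subset n → ℕ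
δ A B = if A ≟S B then 1 else 0

δ-refl : ∀ {n} (A : Subset n) → δ A A ≡ 1
δ-refl A rewrite ≟S-refl A = refl

δ-≢ : ∀ {n} {A B : Subset n} → A ≢ B → δ A B ≡ 0
δ-≢ {A = A} {B} A≢B with A ≟S B in eq
... | true  = contradiction (≟S-sound eq) A≢B
... | false = refl

δ-∷ : ∀ {n} b (A B : Subset n) → δ (b ∷ A) (b ∷ B) ≡ δ A B
δ-∷ b A B with A ≟S B in eq
... | true  rewrite ≟S-sound eq = δ-refl (b ∷ B)
... | false = δ-≢ (≟S-false⇒≢ eq ∘ ∷-injectiveʳ)

δ-∷-≢ : ∀ {n} {a b} → a ≢ b → (A B : Subset n) → δ (a ∷ A) (b ∷ B) ≡ 0
δ-∷-≢ a≢b A B = δ-≢ (a≢b ∘ ∷-injectiveˡ)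

δ-sym-involution : ∀ {n} (σ : Subset n → Subset n) → (∀ A → σ (σ A) ≡ A) → ∀ A B → δ B (σ A) ≡ δ A (σ B)
δ-sym-involution σ σσ A B with B ≟S σ A in eq
... | true  rewrite ≟S-sound eq | σσ A = sym (δ-refl A)
... | false = sym (δ-≢ λ A≡σB → ≟S-false⇒≢ eq (sym (trans (cong σ A≡σB) (σσ B))))

sumOver-allSubsets-δ : ∀ n (B : Subset n) (h : Subset n → ℕ) → sumOver (allSubsets n) (λ A → δ A B * h A) ≡ h B
sumOver-allSubsets-δ zero    []      h = trans (+-identityʳ _) (*-identityˡ (h []))
sumOver-allSubsets-δ (suc n) (b ∷ B) h = trans (sumOver-allSubsets-suc n (λ A → δ A (b ∷ B) * h A)) (halves b)
  where
  kept : ∀ b → sumOver (allSubsets n) (λ A → δ (b ∷ A) (b ∷ B) * h (b ∷ A)) ≡ h (b ∷ B)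
  kept b = trans (sumOver-cong (allSubsets n) λ A → cong (_* h (b ∷ A)) (δ-∷ b A B)) (sumOver-allSubsets-δ n B (h ∘ (b ∷_)))
  vanishing : ∀ {a b} → a ≢ b → sumOver (allSubsets n) (λ A → δ (a ∷ A) (b ∷ B) * h (a ∷ A)) ≡ 0
  vanishing {a} a≢b = trans (sumOver-cong (allSubsets n) λ A → cong (_* h (a ∷ A)) (δ-∷-≢ a≢b A B)) (sumOver-zero (allSubsets n))
  halves : ∀ b → sumOver (allSubsets n) (λ A → δ (true ∷ A) (b ∷ B) * h (true ∷ A))
                 + sumOver (allSubsets n) (λ A → δ (false ∷ A) (b ∷ B) * h (false ∷ A)) ≡ h (b ∷ B)
  halves true  = trans (cong₂ _+_ (kept true) (vanishing {false} {true} λ ())) (+-identityʳ _)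
  halves false = cong₂ _+_ (vanishing {true} {false} λ ()) (kept false)

-- Expanding f (σ A) as Σ_B δ B (σ A) f B and exchanging the sums.
sumOver-allSubsets-involution : ∀ n (σ : Subset n → Subset n) → (∀ A → σ (σ A) ≡ A) → ∀ (f : Subset n → ℕ) →
                                sumOver (allSubsets n) (f ∘ σ) ≡ sumOver (allSubsets n) f
sumOver-allSubsets-involution n σ σσ f = begin
  sumOver L (f ∘ σ)                                       ≡⟨ sumOver-cong L (λ A → sym (sumOver-allSubsets-δ n (σ A) f)) ⟩
  sumOver L (λ A → sumOver L (λ B → δ B (σ A) * f B))     ≡⟨ sumOver-comm L L (λ A B → δ B (σ A) * f B) ⟩
  sumOver L (λ B → sumOver L (λ A → δ B (σ A) * f B))     ≡⟨ sumOver-cong L (λ B → sumOver-*ʳ L (λ A → δ B (σ A)) (f B)) ⟩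
  sumOver L (λ B → sumOver L (λ A → δ B (σ A)) * f B)     ≡⟨ sumOver-cong L (λ B → cong (_* f B) (count-σ B)) ⟩
  sumOver L (λ B → 1 * f B)                               ≡⟨ sumOver-cong L (λ B → *-identityˡ (f B)) ⟩
  sumOver L f                                             ∎
  where
  open ≡-Reasoning
  L : List (Subset n)
  L = allSubsets n
  count-σ : ∀ B → sumOver L (λ A → δ B (σ A)) ≡ 1
  count-σ B = trans (sumOver-cong L (λ A → trans (δ-sym-involution σ σσ A B) (sym (*-identityʳ (δ A (σ B))))))
                    (sumOver-allSubsets-δ n (σ B) (λ _ → 1))

all-∈ : ∀ {A : Set} (p : A → Bool) {xs x} → all p xs ≡ true → x ∈ xs → p x ≡ true
all-∈ p {xs} h x∈xs = Equivalence.to T-≡ (All.lookup (all⁺ p xs (Equivalence.from T-≡ h)) x∈xs)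

all-intro : ∀ {A : Set} (p : A → Bool) xs → (∀ x → p x ≡ true) → all p xs ≡ true
all-intro p xs h = Equivalence.to T-≡ (all⁻ p {xs} (All.tabulate λ {x} _ → Equivalence.from T-≡ (h x)))

all-witness : ∀ {A : Set} (p : A → Bool) xs → all p xs ≡ false → Σ A λ x → p x ≡ false
all-witness p (x ∷ xs) h with p x in px
... | true  = all-witness p xs h
... | false = x , px

Clique : ∀ {n} → Graph n → Subset n → Set
Clique {n} H A = ∀ (u v : Fin n) → lookup A u ≡ true → lookup A v ≡ true → u ≢ v → Adj H u v

module _ {n : ℕ} (H : Graph n) (A : Subset n) where

  private
    entry : Fin n → Fin n → Bool
    entry u v = not (lookup A u) ∨ not (lookup A v) ∨ ⌊ u ≟F v ⌋ ∨ H (pair u v)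

    entry-edge : ∀ {u v} → lookup A u ≡ true → lookup A v ≡ true → u ≢ v → entry u v ≡ H (pair u v)
    entry-edge {u} {v} Au Av u≢v rewrite Au | Av with u ≟F v
    ... | yes u≡v = contradiction u≡v u≢v
    ... | no  _   = refl

  cliqueB-sound : cliqueB H A ≡ true → Clique H A
  cliqueB-sound h u v Au Av u≢v =
    trans (sym (entry-edge Au Av u≢v)) (all-∈ (entry u) (all-∈ _ h (∈-allFin u)) (∈-allFin v))

  cliqueB-complete : Clique H A → cliqueB H A ≡ true
  cliqueB-complete clique = all-intro _ (allFin n) λ u → all-intro _ (allFin n) λ v → entry-true u v
    where
    entry-true : ∀ u v → entry u v ≡ true
    entry-true u v with lookup A u in Au | lookup A v in Av | u ≟F v
    ... | false | _     | _        = refl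
    ... | true  | false | _        = refl
    ... | true  | true  | yes _    = refl
    ... | true  | true  | no  u≢v  = clique u v Au Av u≢v

  cliqueB-false⇒¬Clique : cliqueB H A ≡ false → ¬ Clique H A
  cliqueB-false⇒¬Clique h clique = true≢false (trans (sym (cliqueB-complete clique)) h)

  cliqueB-witness : cliqueB H A ≡ false → Σ (Fin n) λ u → Σ (Fin n) λ v →
                    lookup A u ≡ true × lookup A v ≡ true × u ≢ v × ¬ Adj H u v
  cliqueB-witness h with all-witness (λ u → all (entry u) (allFin n)) (allFin n) h
  ... | u , hu with all-witness (entry u) (allFin n) hu
  ...   | v , huv with lookup A u in Au | lookup A v in Av | u ≟F v
  ...     | true  | true  | no u≢v = u , v , Au , Av , u≢v , λ uv → true≢false (trans (sym uv) huv)

cliqueB-cong : ∀ {n} {G H : Graph n} {A B} → (Clique G A → Clique H B) → (Clique H B → Clique G A) → cliqueB G A ≡ cliqueB H B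
cliqueB-cong {G = G} {H} {A} {B} G⇒H H⇒G with cliqueB G A in gA | cliqueB H B in hB
... | true  | true  = refl
... | false | false = refl
... | true  | false = contradiction (G⇒H (cliqueB-sound G A gA)) (cliqueB-false⇒¬Clique H B hB)
... | false | true  = contradiction (H⇒G (cliqueB-sound H B hB)) (cliqueB-false⇒¬Clique G A gA)

⟦_⟧ : Bool → ℕ
⟦ b ⟧ = if b then 1 else 0

⟦∨⟧+⟦∧⟧ : ∀ a b → ⟦ a ∨ b ⟧ + ⟦ a ∧ b ⟧ ≡ ⟦ a ⟧ + ⟦ b ⟧
⟦∨⟧+⟦∧⟧ true  true  = refl
⟦∨⟧+⟦∧⟧ true  false = refl
⟦∨⟧+⟦∧⟧ false true  = refl
⟦∨⟧+⟦∧⟧ false false = refl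

⟦∧⟧+⟦∧⟧-cong : ∀ c {a b a′ b′} → ⟦ a ⟧ + ⟦ b ⟧ ≡ ⟦ a′ ⟧ + ⟦ b′ ⟧ → ⟦ c ∧ a ⟧ + ⟦ c ∧ b ⟧ ≡ ⟦ c ∧ a′ ⟧ + ⟦ c ∧ b′ ⟧
⟦∧⟧+⟦∧⟧-cong true  eq = eq
⟦∧⟧+⟦∧⟧-cong false _  = refl

+-double-injective : ∀ {x y} → x + x ≡ y + y → x ≡ y
+-double-injective {x} {y} eq = *-cancelˡ-≡ x y 2 (trans (cong (x +_) (+-identityʳ x)) (trans eq (cong (y +_) (sym (+-identityʳ y)))))

module ShiftCliques {n : ℕ} (G : Graph n) (chordal : Chordal G) {i j : Fin n} (i≢j : i ≢ j) (ij : Adj G i j) where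

  private
    H : Graph n
    H = Shift G i j

  open ShiftAdjacency G i≢j
  open Swap i≢j
  open Cycles.ChordalRelProperties (Adj G) (Adj-sym G) (Chordal⇒ChordalRel G chordal) using (chordless-square-impossible)

  Clique-by-incidence : ∀ (K : Graph n) {A} → (∀ {u v} → Adj K u v → Adj K v u) →
    (lookup A i ≡ true → lookup A j ≡ true → Adj K i j) →
    (∀ {x} → lookup A x ≡ true → x ≢ i → x ≢ j → lookup A i ≡ true → Adj K i x) →
    (∀ {x} → lookup A x ≡ true → x ≢ i → x ≢ j → lookup A j ≡ true → Adj K j x) →
    (∀ {x y} → lookup A x ≡ true → lookup A y ≡ true → x ≢ i → x ≢ j → y ≢ i → y ≢ j → x ≢ y → Adj K x y) →
    Clique K A
  Clique-by-incidence K K-sym i-j i-x j-x x-y u v Au Av u≢v with u ≟F i | u ≟F j | v ≟F i | v ≟F j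
  ... | yes refl | _        | yes refl | _        = contradiction refl u≢v
  ... | yes refl | _        | no  _    | yes refl = i-j Au Av
  ... | yes refl | _        | no  v≢i  | no  v≢j  = i-x Av v≢i v≢j Au
  ... | no  _    | yes refl | yes refl | _        = K-sym (i-j Av Au)
  ... | no  _    | yes refl | no  _    | yes refl = contradiction refl u≢v
  ... | no  _    | yes refl | no  v≢i  | no  v≢j  = j-x Av v≢i v≢j Au
  ... | no  u≢i  | no  u≢j  | yes refl | _        = K-sym (i-x Au u≢i u≢j Av)
  ... | no  u≢i  | no  u≢j  | no  _    | yes refl = K-sym (j-x Au u≢i u≢j Av)
  ... | no  u≢i  | no  u≢j  | no  v≢i  | no  v≢j  = x-y Au Av u≢i u≢j v≢i v≢j u≢v

  Clique-without-j⁺ : ∀ {A} → lookup A j ≡ false → Clique G A → Clique H A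
  Clique-without-j⁺ {A} Aj clique u v Au Av u≢v = adj⁺-avoiding-j (≢j Au) (≢j Av) (clique u v Au Av u≢v)
    where
    ≢j : ∀ {x} → lookup A x ≡ true → x ≢ j
    ≢j = lookup≡false⇒≢ {A = A} Aj

  Clique-without-ij⁻ : ∀ {A} → lookup A i ≡ false → lookup A j ≡ false → Clique H A → Clique G A
  Clique-without-ij⁻ {A} Ai Aj clique u v Au Av u≢v = adj⁻-avoiding-ij (≢i Au) (≢j Au) (≢i Av) (≢j Av) (clique u v Au Av u≢v)
    where
    ≢i : ∀ {x} → lookup A x ≡ true → x ≢ i
    ≢i = lookup≡false⇒≢ {A = A} Ai
    ≢j : ∀ {x} → lookup A x ≡ true → x ≢ j
    ≢j = lookup≡false⇒≢ {A = A} Aj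

  Clique-with-ij⁺ : ∀ {A} → lookup A i ≡ true → lookup A j ≡ true → Clique G A → Clique H A
  Clique-with-ij⁺ {A} Ai Aj clique = Clique-by-incidence H {A} (Adj-sym H)
    (λ _ _ → adj⁺-ij ij)
    (λ {x} Ax x≢i x≢j _ → adj⁺-avoiding-j i≢j x≢j (clique i x Ai Ax (≢-sym x≢i)))
    (λ {x} Ax x≢i x≢j _ → adj⁺-j x≢i x≢j (clique j x Aj Ax (≢-sym x≢j)) (clique i x Ai Ax (≢-sym x≢i)))
    (λ {x} {y} Ax Ay _ x≢j _ y≢j x≢y → adj⁺-avoiding-j x≢j y≢j (clique x y Ax Ay x≢y))

  Clique-with-ij⁻ : ∀ {A} → lookup A i ≡ true → lookup A j ≡ true → Clique H A → Clique G A
  Clique-with-ij⁻ {A} Ai Aj clique = Clique-by-incidence G {A} (Adj-sym G)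
    (λ _ _ → ij)
    (λ {x} Ax x≢i x≢j _ → proj₂ (adj⁻-j x≢i x≢j (clique j x Aj Ax (≢-sym x≢j))))
    (λ {x} Ax x≢i x≢j _ → proj₁ (adj⁻-j x≢i x≢j (clique j x Aj Ax (≢-sym x≢j))))
    (λ {x} {y} Ax Ay x≢i x≢j y≢i y≢j x≢y → adj⁻-avoiding-ij x≢i x≢j y≢i y≢j (clique x y Ax Ay x≢y))

  cliqueB-balanced : ∀ A → lookup A i ≡ lookup A j → cliqueB G A ≡ cliqueB H A
  cliqueB-balanced A Ai≡Aj with lookup A i in Ai | lookup A j in Aj
  ... | true  | true  = cliqueB-cong {G = G} {H} {A} {A} (Clique-with-ij⁺ {A} Ai Aj) (Clique-with-ij⁻ {A} Ai Aj)
  ... | false | false = cliqueB-cong {G = G} {H} {A} {A} (Clique-without-j⁺ {A} Aj) (Clique-without-ij⁻ {A} Ai Aj)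
  ... | true  | false = contradiction Ai≡Aj λ ()
  ... | false | true  = contradiction Ai≡Aj λ ()

  module Unbalanced (A : Subset n) (Ai : lookup A i ≡ true) (Aj : lookup A j ≡ false) where

    B : Subset n
    B = swap A

    Bi : lookup B i ≡ false
    Bi = trans (lookup-swap-i A) Aj

    Bj : lookup B j ≡ true
    Bj = trans (lookup-swap-j A) Ai

    A⇒B : ∀ {x} → x ≢ i → x ≢ j → lookup A x ≡ true → lookup B x ≡ true
    A⇒B x≢i x≢j Ax = trans (lookup-swap-other A x≢i x≢j) Ax

    B⇒A : ∀ {x} → x ≢ i → x ≢ j → lookup B x ≡ true → lookup A x ≡ true
    B⇒A x≢i x≢j Bx = trans (sym (lookup-swap-other A x≢i x≢j)) Bx

    Clique-swap⇒Clique-H : Clique G B → Clique H A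
    Clique-swap⇒Clique-H clique = Clique-by-incidence H {A} (Adj-sym H)
      (λ _ Aj′ → contradiction (trans (sym Aj′) Aj) λ ())
      (λ {x} Ax x≢i x≢j _ → adj⁺-i x≢i x≢j (clique j x Bj (A⇒B x≢i x≢j Ax) (≢-sym x≢j)))
      (λ _ _ _ Aj′ → contradiction (trans (sym Aj′) Aj) λ ())
      (λ {x} {y} Ax Ay x≢i x≢j y≢i y≢j x≢y → adj⁺-avoiding-j x≢j y≢j (clique x y (A⇒B x≢i x≢j Ax) (A⇒B y≢i y≢j Ay) x≢y))

    Clique-H-swap⇒Clique : Clique H B → Clique G A
    Clique-H-swap⇒Clique clique = Clique-by-incidence G {A} (Adj-sym G)
      (λ _ Aj′ → contradiction (trans (sym Aj′) Aj) λ ())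
      (λ {x} Ax x≢i x≢j _ → proj₂ (adj⁻-j x≢i x≢j (clique j x Bj (A⇒B x≢i x≢j Ax) (≢-sym x≢j))))
      (λ _ _ _ Aj′ → contradiction (trans (sym Aj′) Aj) λ ())
      (λ {x} {y} Ax Ay x≢i x≢j y≢i y≢j x≢y → adj⁻-avoiding-ij x≢i x≢j y≢i y≢j (clique x y (A⇒B x≢i x≢j Ax) (A⇒B y≢i y≢j Ay) x≢y))

    Clique-H-swap⇒Clique-swap : Clique H B → Clique G B
    Clique-H-swap⇒Clique-swap clique = Clique-by-incidence G {B} (Adj-sym G)
      (λ Bi′ _ → contradiction (trans (sym Bi′) Bi) λ ())
      (λ _ _ _ Bi′ → contradiction (trans (sym Bi′) Bi) λ ())
      (λ {x} Bx x≢i x≢j _ → proj₁ (adj⁻-j x≢i x≢j (clique j x Bj Bx (≢-sym x≢j))))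
      (λ {x} {y} Bx By x≢i x≢j y≢i y≢j x≢y → adj⁻-avoiding-ij x≢i x≢j y≢i y≢j (clique x y Bx By x≢y))

    Cliques⇒Clique-H-swap : Clique G A → Clique G B → Clique H B
    Cliques⇒Clique-H-swap cliqueA cliqueB = Clique-by-incidence H {B} (Adj-sym H)
      (λ Bi′ _ → contradiction (trans (sym Bi′) Bi) λ ())
      (λ _ _ _ Bi′ → contradiction (trans (sym Bi′) Bi) λ ())
      (λ {x} Bx x≢i x≢j _ → adj⁺-j x≢i x≢j (cliqueB j x Bj Bx (≢-sym x≢j)) (cliqueA i x Ai (B⇒A x≢i x≢j Bx) (≢-sym x≢i)))
      (λ {x} {y} Bx By _ x≢j _ y≢j x≢y → adj⁺-avoiding-j x≢j y≢j (cliqueB x y Bx By x≢y))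

    private
      non-neighbour-of-i : Clique H A → cliqueB G A ≡ false →
                           Σ (Fin n) λ x → lookup A x ≡ true × x ≢ i × x ≢ j × ¬ Adj G i x
      non-neighbour-of-i clique gA with cliqueB-witness G A gA
      ... | u , v , Au , Av , u≢v , ¬uv with u ≟F i | v ≟F i
      ...   | yes refl | yes refl = contradiction refl u≢v
      ...   | yes refl | no  v≢i  = v , Av , v≢i , lookup≡false⇒≢ {A = A} Aj Av , ¬uv
      ...   | no  u≢i  | yes refl = u , Au , u≢i , lookup≡false⇒≢ {A = A} Aj Au , ¬uv ∘ Adj-sym G
      ...   | no  u≢i  | no  v≢i  =
        contradiction (adj⁻-avoiding-ij u≢i (lookup≡false⇒≢ {A = A} Aj Au) v≢i (lookup≡false⇒≢ {A = A} Aj Av) (clique u v Au Av u≢v)) ¬uv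

      non-neighbour-of-j : Clique H A → cliqueB G B ≡ false →
                           Σ (Fin n) λ y → lookup A y ≡ true × y ≢ i × y ≢ j × ¬ Adj G j y
      non-neighbour-of-j clique gB with cliqueB-witness G B gB
      ... | u , v , Bu , Bv , u≢v , ¬uv with u ≟F j | v ≟F j
      ...   | yes refl | yes refl = contradiction refl u≢v
      ...   | yes refl | no  v≢j  = v , B⇒A (lookup≡false⇒≢ {A = B} Bi Bv) v≢j Bv , lookup≡false⇒≢ {A = B} Bi Bv , v≢j , ¬uv
      ...   | no  u≢j  | yes refl = u , B⇒A (lookup≡false⇒≢ {A = B} Bi Bu) u≢j Bu , lookup≡false⇒≢ {A = B} Bi Bu , u≢j , ¬uv ∘ Adj-sym G
      ...   | no  u≢j  | no  v≢j  = contradiction (adj⁻-avoiding-ij u≢i u≢j v≢i v≢j (clique u v (B⇒A u≢i u≢j Bu) (B⇒A v≢i v≢j Bv) u≢v)) ¬uv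
        where
        u≢i : u ≢ i
        u≢i = lookup≡false⇒≢ {A = B} Bi Bu
        v≢i : v ≢ i
        v≢i = lookup≡false⇒≢ {A = B} Bi Bv

    -- Non-neighbours x of i and y of j in A would close the chordless square i y x j.
    Clique-H⇒Clique-or-swap : Clique H A → cliqueB G A ≡ false → cliqueB G B ≡ false → ⊥
    Clique-H⇒Clique-or-swap clique gA gB with non-neighbour-of-i clique gA | non-neighbour-of-j clique gB
    ... | x , Ax , x≢i , x≢j , ¬ix | y , Ay , y≢i , y≢j , ¬jy =
      chordless-square-impossible (≢-sym y≢i) (≢-sym x≢i) i≢j y≢x (≢-sym y≢j) (≢-sym x≢j) iy yx (Adj-sym G jx) (Adj-sym G ij) ¬ix ¬jy
      where
      jx : Adj G j x
      jx = ⊎-resolveʳ (adj⁻-i x≢i x≢j (clique i x Ai Ax (≢-sym x≢i))) ¬ix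
      iy : Adj G i y
      iy = ⊎-resolveˡ (adj⁻-i y≢i y≢j (clique i y Ai Ay (≢-sym y≢i))) ¬jy
      y≢x : y ≢ x
      y≢x refl = ¬jy jx
      yx : Adj G y x
      yx = adj⁻-avoiding-ij y≢i y≢j x≢i x≢j (clique y x Ay Ax y≢x)

    cliqueB-H : cliqueB H A ≡ cliqueB G A ∨ cliqueB G B
    cliqueB-H with cliqueB G A in gA | cliqueB G B in gB
    ... | true  | _     = cliqueB-complete H A (Clique-without-j⁺ {A} Aj (cliqueB-sound G A gA))
    ... | false | true  = cliqueB-complete H A (Clique-swap⇒Clique-H (cliqueB-sound G B gB))
    ... | false | false with cliqueB H A in hA
    ...   | true  = ⊥-elim (Clique-H⇒Clique-or-swap (cliqueB-sound H A hA) gA gB)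
    ...   | false = refl

    cliqueB-H-swap : cliqueB H B ≡ cliqueB G A ∧ cliqueB G B
    cliqueB-H-swap with cliqueB G A in gA | cliqueB G B in gB | cliqueB H B in hB
    ... | true  | true  | true  = refl
    ... | true  | true  | false = contradiction (Cliques⇒Clique-H-swap (cliqueB-sound G A gA) (cliqueB-sound G B gB))
                                                (cliqueB-false⇒¬Clique H B hB)
    ... | false | _     | true  = contradiction (Clique-H-swap⇒Clique (cliqueB-sound H B hB)) (cliqueB-false⇒¬Clique G A gA)
    ... | true  | false | true  = contradiction (Clique-H-swap⇒Clique-swap (cliqueB-sound H B hB)) (cliqueB-false⇒¬Clique G B gB)
    ... | false | _     | false = refl
    ... | true  | false | false = refl

    cliqueB-count : ⟦ cliqueB H A ⟧ + ⟦ cliqueB H B ⟧ ≡ ⟦ cliqueB G A ⟧ + ⟦ cliqueB G B ⟧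
    cliqueB-count = trans (cong₂ _+_ (cong ⟦_⟧ cliqueB-H) (cong ⟦_⟧ cliqueB-H-swap)) (⟦∨⟧+⟦∧⟧ (cliqueB G A) (cliqueB G B))

  cliqueB-pair : ∀ A → ⟦ cliqueB H A ⟧ + ⟦ cliqueB H (swap A) ⟧ ≡ ⟦ cliqueB G A ⟧ + ⟦ cliqueB G (swap A) ⟧
  cliqueB-pair A with lookup A i ≟B lookup A j
  ... | yes Ai≡Aj rewrite swap-fixed A Ai≡Aj | cliqueB-balanced A Ai≡Aj = refl
  ... | no  Ai≢Aj = unbalanced (lookup A i) (lookup A j) refl refl Ai≢Aj
    where
    unbalanced : ∀ a b → lookup A i ≡ a → lookup A j ≡ b → a ≢ b →
                 ⟦ cliqueB H A ⟧ + ⟦ cliqueB H (swap A) ⟧ ≡ ⟦ cliqueB G A ⟧ + ⟦ cliqueB G (swap A) ⟧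
    unbalanced true  true  _  _  a≢b = contradiction refl a≢b
    unbalanced false false _  _  a≢b = contradiction refl a≢b
    unbalanced true  false Ai Aj _   = Unbalanced.cliqueB-count A Ai Aj
    unbalanced false true  Ai Aj _   = begin
      ⟦ cliqueB H A ⟧ + ⟦ cliqueB H (swap A) ⟧ ≡⟨ +-comm ⟦ cliqueB H A ⟧ _ ⟩
      ⟦ cliqueB H (swap A) ⟧ + ⟦ cliqueB H A ⟧ ≡⟨ cong (λ S → ⟦ cliqueB H (swap A) ⟧ + ⟦ cliqueB H S ⟧) (sym (swap-involutive A)) ⟩
      ⟦ cliqueB H B ⟧ + ⟦ cliqueB H (swap B) ⟧ ≡⟨ Unbalanced.cliqueB-count B (trans (lookup-swap-i A) Aj) (trans (lookup-swap-j A) Ai) ⟩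
      ⟦ cliqueB G B ⟧ + ⟦ cliqueB G (swap B) ⟧ ≡⟨ cong (λ S → ⟦ cliqueB G (swap A) ⟧ + ⟦ cliqueB G S ⟧) (swap-involutive A) ⟩
      ⟦ cliqueB G (swap A) ⟧ + ⟦ cliqueB G A ⟧ ≡⟨ +-comm ⟦ cliqueB G (swap A) ⟧ _ ⟩
      ⟦ cliqueB G A ⟧ + ⟦ cliqueB G (swap A) ⟧ ∎
      where
      open ≡-Reasoning
      B : Subset n
      B = swap A

  inTk-pair : ∀ k A → ⟦ inTk k H A ⟧ + ⟦ inTk k H (swap A) ⟧ ≡ ⟦ inTk k G A ⟧ + ⟦ inTk k G (swap A) ⟧
  inTk-pair k A rewrite ∣swap∣ A = ⟦∧⟧+⟦∧⟧-cong (∣ A ∣ ≡ᵇ k) (cliqueB-pair A)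

  Shift-card-T : ∀ k → card-T k G ≡ card-T k H
  Shift-card-T k = +-double-injective (begin
    count G + count G                                  ≡⟨ cong (count G +_) (sym (sumOver-allSubsets-involution n swap swap-involutive (F G))) ⟩
    count G + sumOver L (F G ∘ swap)                   ≡⟨ sym (sumOver-+ L (F G) (F G ∘ swap)) ⟩
    sumOver L (λ A → F G A + F G (swap A))             ≡⟨ sumOver-cong L (λ A → sym (inTk-pair k A)) ⟩
    sumOver L (λ A → F H A + F H (swap A))             ≡⟨ sumOver-+ L (F H) (F H ∘ swap) ⟩
    count H + sumOver L (F H ∘ swap)                   ≡⟨ cong (count H +_) (sumOver-allSubsets-involution n swap swap-involutive (F H)) ⟩
    count H + count H                                  ∎)
    where
    open ≡-Reasoning
    L : List (Subset n)
    L = allSubsets n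
    F : Graph n → Subset n → ℕ
    F K A = ⟦ inTk k K A ⟧
    count : Graph n → ℕ
    count K = sumOver L (F K)

lemma4p7 : {n : ℕ} (G : Graph n) → IsSimpleGraph G → Chordal G →
    (i j : Fin n) → i Fin.< j → Adj G i j →
    Chordal (Shift G i j)
    × (∀ (k : ℕ) → 1 ≤ k → k ≤ n → card-T k G ≡ card-T k (Shift G i j))
    × (∀ (k : ℕ) → KConnected k G → KConnected k (Shift G i j))
lemma4p7 G simple chordal i j i<j ij =
  ShiftChordality.Shift-chordal G chordal i≢j ij ,
  (λ k _ _ → ShiftCliques.Shift-card-T G chordal i≢j ij k) ,
  ShiftConnectivity.Shift-KConnected G simple chordal i≢j ij
  where
  i≢j : i ≢ j
  i≢j = <⇒≢ i<j
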